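{- Let $\mathbb{K}$ be a field of characteristic $0$, let $L=\sum_{i=0}^{J}a_i(k)\sigma^i\in \mathbb{K}[k][\sigma]$ with $a_J(k)\ne0$ be power-partible with respect to $\gamma\in\mathbb{K}$, and let $d=\deg(L)$. For each $s\in\mathbb{N}$ let $\alpha_s\in\mathbb{K}\setminus\{0\}$ and $x_{s}(k)=\alpha_s\,(k-\gamma+\tfrac{J}{2})^s$. Then for every positive integer $m$ there exist $u_i,v_j\in\mathbb{K}$ such that $$(k-\gamma)^m=\sum_{\substack{0\le i<d\\ i\equiv m \pmod 2}}u_i(k-\gamma)^i+\sum_{\substack{0\le j\le m-d\\ d+j\equiv m \pmod 2}}v_j\,L^\ast(x_j(k)).$$
   Context: $\sigma$ is the shift operator, $\sigma F(k)=F(k+1)$. The adjoint of $L$ acts on polynomials by $L^{\ast}(x(k))=\sum_{i=0}^{J}a_i(k-i)x(k-i)$. Set $b_{\ell}(k)=\sum_{j=\ell}^{J}\binom{j}{\ell}a_{J-j}(k+j-J)$ for $0\le\ell\le J$ and $d=\deg(L)=\max_{0\le\ell\le J}\{\deg b_\ell(k)-\ell\}$. Let $f(s)=\sum_{\ell=0}^{J}[k^{d+\ell}](b_\ell(k))\,s^{\underline{\ell}}$ ($[k^m](b)$ the coefficient of $k^m$ in $b$, $s^{\underline{\ell}}=s(s-1)\cdots(s-\ell+1)$); $L$ is nondegenerated if $f$ has no root in $\mathbb{N}=\{0,1,2,\dots\}$. $L$ is called power-partible with respect to $\gamma$ if $L$ is nondegenerated and $a_i(\gamma+k)=(-1)^d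 a_{J-i}(\gamma-k-J)$ for $i=0,1,\ldots,\lfloor J/2\rfloor$. -}

module Defs where

open import Level using (Level; _⊔_)
open import Algebra.Bundles using (CommutativeRing)
open import Data.Nat as ℕ using (ℕ; zero; suc; _∸_; ⌊_/2⌋)
open import Data.Nat.Combinatorics using (_C_)
open import Data.Integer as ℤ using (ℤ; +_; -[1+_])
open import Data.Bool using (Bool; true; false; if_then_else_)
open import Data.List using (List; []; _∷_; foldr; map)
open import Data.Product using (Σ; _×_)
open import Relation.Nullary using (¬_)

evenℕ : ℕ → Bool
evenℕ zero = true
evenℕ (suc n) with evenℕ n
... | true = false
... | false = true

evenℤ : ℤ → Bool
evenℤ (+ n) = evenℕ n
evenℤ -[1+ n ] = evenℕ (suc n)

natPart : ℤ → ℕ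
natPart (+ n) = n
natPart -[1+ n ] = 0

module PolyDefs {c ℓ : Level} (R : CommutativeRing c ℓ) where
  open CommutativeRing R

  IsField : Set (c ⊔ ℓ)
  IsField = (¬ (1# ≈ 0#)) × (∀ x → ¬ (x ≈ 0#) → Σ Carrier λ y → x * y ≈ 1#)

  fromℕ : ℕ → Carrier
  fromℕ zero = 0#
  fromℕ (suc n) = 1# + fromℕ n

  fromℤ : ℤ → Carrier
  fromℤ (+ n) = fromℕ n
  fromℤ -[1+ n ] = - fromℕ (suc n)

  CharZero : Set ℓ
  CharZero = ∀ n → ¬ (fromℕ (suc n) ≈ 0#)

  -- univariate polynomials in k: coefficient lists, lowest degree first
  Poly : Set c
  Poly = List Carrier

  coeff : Poly → ℕ → Carrier
  coeff [] n = 0#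
  coeff (x ∷ p) zero = x
  coeff (x ∷ p) (suc n) = coeff p n

  coeffℤ : Poly → ℤ → Carrier
  coeffℤ p (+ n) = coeff p n
  coeffℤ p -[1+ n ] = 0#

  infix 4 _≈ₚ_
  _≈ₚ_ : Poly → Poly → Set ℓ
  p ≈ₚ q = ∀ n → coeff p n ≈ coeff q n

  infixl 6 _⊕_
  _⊕_ : Poly → Poly → Poly
  [] ⊕ q = q
  (x ∷ p) ⊕ [] = x ∷ p
  (x ∷ p) ⊕ (y ∷ q) = (x + y) ∷ (p ⊕ q)

  scal : Carrier → Poly → Poly
  scal a p = map (a *_) p

  mulK : Poly → Poly
  mulK p = 0# ∷ p

  infixl 7 _⊛_
  _⊛_ : Poly → Poly → Poly
  p ⊛ q = foldr (λ x r → scal x q ⊕ mulK r) [] p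

  pow : Poly → ℕ → Poly
  pow p zero = 1# ∷ []
  pow p (suc n) = p ⊛ pow p n

  -- compLin α β p  is the polynomial  p(α k + β)
  compLin : Carrier → Carrier → Poly → Poly
  compLin α β = foldr (λ x q → (x ∷ []) ⊕ (mulK (scal α q) ⊕ scal β q)) []

  shift : Carrier → Poly → Poly
  shift c p = compLin 1# c p

  sumₚ : ℕ → (ℕ → Poly) → Poly
  sumₚ zero P = []
  sumₚ (suc N) P = sumₚ N P ⊕ P N

  sumK : ℕ → (ℕ → Carrier) → Carrier
  sumK zero f = 0#
  sumK (suc N) f = sumK N f + f N

  -- An operator L = Σ_{i=0}^{J} a_i(k) σ^i is given by J and a : ℕ → Poly
  -- (only a 0, …, a J are relevant).

  adjoint : ℕ → (ℕ → Poly) → Poly → Poly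
  adjoint J a x = sumₚ (suc J) (λ i → shift (- fromℕ i) (a i ⊛ x))

  -- b_ℓ(k) = Σ_{j=ℓ}^{J} binom(j,ℓ) a_{J-j}(k+j-J)
  bpoly : ℕ → (ℕ → Poly) → ℕ → Poly
  bpoly J a l = sumₚ (suc J ∸ l) (λ t →
    scal (fromℕ ((l ℕ.+ t) C l))
         (shift (fromℤ (+ (l ℕ.+ t) ℤ.- + J)) (a (J ∸ (l ℕ.+ t)))))

  -- d = deg(L) = max_{0≤ℓ≤J} (deg b_ℓ − ℓ): every b_ℓ has degree ≤ d+ℓ,
  -- and some b_ℓ has a nonzero coefficient at k^{d+ℓ}.
  IsDeg : ℕ → (ℕ → Poly) → ℤ → Set ℓ
  IsDeg J a d =
    (∀ l → l ℕ.≤ J → ∀ n → d ℤ.+ + l ℤ.< + n → coeff (bpoly J a l) n ≈ 0#)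
    × Σ ℕ (λ l → l ℕ.≤ J × ¬ (coeffℤ (bpoly J a l) (d ℤ.+ + l) ≈ 0#))

  fall : Carrier → ℕ → Carrier
  fall s zero = 1#
  fall s (suc l) = fall s l * (s - fromℕ l)

  indPoly : ℕ → (ℕ → Poly) → ℤ → Carrier → Carrier
  indPoly J a d s = sumK (suc J) (λ l → coeffℤ (bpoly J a l) (d ℤ.+ + l) * fall s l)

  Nondegenerated : ℕ → (ℕ → Poly) → ℤ → Set ℓ
  Nondegenerated J a d = ∀ (s : ℕ) → ¬ (indPoly J a d (fromℕ s) ≈ 0#)

  negOnePow : ℤ → Carrier
  negOnePow d = if evenℤ d then 1# else - 1#

  -- power-partible w.r.t. γ (d = deg L):
  -- a_i(γ+k) = (-1)^d a_{J-i}(γ-k-J) for i = 0..⌊J/2⌋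
  PowerPartible : ℕ → (ℕ → Poly) → Carrier → ℤ → Set ℓ
  PowerPartible J a γ d = Nondegenerated J a d ×
    (∀ i → i ℕ.≤ ⌊ J /2⌋ →
       shift γ (a i) ≈ₚ scal (negOnePow d) (compLin (- 1#) (γ - fromℕ J) (a (J ∸ i))))

  sumIf : ℕ → (ℕ → Bool) → (ℕ → Poly) → Poly
  sumIf N b P = sumₚ N (λ i → if b i then P i else [])

module Submission where

-- Put t = k − γ. Newton's formula gives L*(x)(k) = Σ_ℓ b_ℓ(k) Δ^ℓ x(k − J), so for x of degree j with
-- leading coefficient c, L*(x) has degree d + j with top coefficient c · f(j), nonzero by nondegeneracy.
-- Since 2h = J, power-partibility makes t ↦ −t exchange the summands i and J − i of L*(x_j), so
-- L*(x_j)(γ − t) = (−1)^{d+j} L*(x_j)(γ + t): only powers t^n with n ≡ d + j occur. Hence t^m is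
-- reduced, top coefficient first, by the t^i (i < d) and the L*(x_j) (d + j ≤ m) of matching parity.
-- Polynomial identities are verified pointwise, which suffices over an infinite field.

open import Defs
open import Level using (Level; _⊔_)
open import Algebra.Bundles using (CommutativeRing; Semiring)
import Algebra.Solver.Ring.AlmostCommutativeRing as ACR
open import Data.Bool using (Bool; true; false; if_then_else_; not; _xor_)
import Data.Bool.Properties as Bool
open import Data.Empty using (⊥-elim)
open import Data.Integer as ℤ using (ℤ; +_; -[1+_]; _⊖_)
import Data.Integer.Properties as ℤ
open import Data.List using ([]; _∷_; length)
open import Data.Maybe using (Maybe; just; nothing)
open import Data.Nat using (ℕ; zero; suc; z≤n; s≤s; ⌊_/2⌋)
import Data.Nat as ℕ
import Data.Nat.Properties as ℕ
open import Data.Nat.Combinatorics using (_C_; nCk+nC[k+1]≡[n+1]C[k+1]; k>n⇒nCk≡0)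
open import Data.Product using (Σ; _,_; proj₁; proj₂)
open import Data.Sign as Sign using ()
open import Data.Sum using (_⊎_; inj₁; inj₂)
open import Relation.Binary.Definitions using (tri<; tri≈; tri>)
open import Relation.Binary.PropositionalEquality as ≡ using (_≡_)
open import Relation.Nullary using (¬_; Dec; yes; no)
open import Function using (case_of_)

evenℕ-suc : ∀ n → evenℕ (suc n) ≡ not (evenℕ n)
evenℕ-suc n with evenℕ n
... | true = ≡.refl
... | false = ≡.refl

evenℕ-suc-suc : ∀ n → evenℕ (suc (suc n)) ≡ evenℕ n
evenℕ-suc-suc n with evenℕ n
... | true = ≡.refl
... | false = ≡.refl

evenℕ-+ : ∀ x y → evenℕ (x ℕ.+ y) ≡ not (evenℕ x xor evenℕ y)
evenℕ-+ zero y = ≡.sym (Bool.not-involutive (evenℕ y))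
evenℕ-+ (suc x) y = begin
  evenℕ (suc (x ℕ.+ y))             ≡⟨ evenℕ-suc (x ℕ.+ y) ⟩
  not (evenℕ (x ℕ.+ y))             ≡⟨ ≡.cong not (evenℕ-+ x y) ⟩
  not (not (evenℕ x xor evenℕ y))   ≡⟨ ≡.cong not (Bool.not-distribˡ-xor (evenℕ x) (evenℕ y)) ⟩
  not (not (evenℕ x) xor evenℕ y)   ≡⟨ ≡.cong (λ e → not (e xor evenℕ y)) (≡.sym (evenℕ-suc x)) ⟩
  not (evenℕ (suc x) xor evenℕ y)   ∎
  where open ≡.≡-Reasoning

evenℤ-⊖ : ∀ x y → evenℤ (x ⊖ y) ≡ evenℕ (x ℕ.+ y)
evenℤ-⊖ zero zero = ≡.refl
evenℤ-⊖ (suc x) zero = ≡.cong evenℕ (≡.sym (ℕ.+-identityʳ (suc x)))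
evenℤ-⊖ zero (suc y) = ≡.refl
evenℤ-⊖ (suc x) (suc y) = begin
  evenℤ (suc x ⊖ suc y)        ≡⟨ ≡.cong evenℤ (ℤ.[1+m]⊖[1+n]≡m⊖n x y) ⟩
  evenℤ (x ⊖ y)                ≡⟨ evenℤ-⊖ x y ⟩
  evenℕ (x ℕ.+ y)              ≡⟨ ≡.sym (evenℕ-suc-suc (x ℕ.+ y)) ⟩
  evenℕ (suc (suc (x ℕ.+ y)))  ≡⟨ ≡.cong (λ n → evenℕ (suc n)) (≡.sym (ℕ.+-suc x y)) ⟩
  evenℕ (suc x ℕ.+ suc y)      ∎
  where open ≡.≡-Reasoning

evenℤ-difference : ∀ x y → evenℕ x ≡ evenℕ y → evenℤ (+ x ℤ.- + y) ≡ true
evenℤ-difference x y x≡y = begin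
  evenℤ (+ x ℤ.- + y)                ≡⟨ ≡.cong evenℤ (ℤ.m-n≡m⊖n x y) ⟩
  evenℤ (x ⊖ y)                      ≡⟨ evenℤ-⊖ x y ⟩
  evenℕ (x ℕ.+ y)                    ≡⟨ evenℕ-+ x y ⟩
  not (evenℕ x xor evenℕ y)          ≡⟨ ≡.cong (λ e → not (e xor evenℕ y)) x≡y ⟩
  not (evenℕ y xor evenℕ y)          ≡⟨ ≡.cong not (Bool.xor-same (evenℕ y)) ⟩
  true                               ∎
  where open ≡.≡-Reasoning

module _ {c ℓ : Level} (R : CommutativeRing c ℓ) where
  open CommutativeRing R
  open PolyDefs R
  open import Algebra.Properties.Ring ring
    using (-‿involutive; -‿distribˡ-*; -‿distribʳ-*; -0#≈0#; -1*x≈-x; x∙y⁻¹≈ε⇒x≈y)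
  open import Algebra.Properties.AbelianGroup +-abelianGroup using (⁻¹-∙-comm)
  open import Relation.Binary.Reasoning.Setoid setoid
  open import Algebra.Definitions.RawSemiring (Semiring.rawSemiring semiring) using (_^_)
  open import Algebra.Properties.Semiring.Exp semiring using (^-congˡ)

  fromℕ-+ : ∀ m n → fromℕ (m ℕ.+ n) ≈ fromℕ m + fromℕ n
  fromℕ-+ zero n = sym (+-identityˡ _)
  fromℕ-+ (suc m) n = trans (+-congˡ (fromℕ-+ m n)) (sym (+-assoc _ _ _))

  fromℕ-* : ∀ m n → fromℕ (m ℕ.* n) ≈ fromℕ m * fromℕ n
  fromℕ-* zero n = sym (zeroˡ _)
  fromℕ-* (suc m) n = begin
    fromℕ (n ℕ.+ m ℕ.* n)           ≈⟨ fromℕ-+ n (m ℕ.* n) ⟩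
    fromℕ n + fromℕ (m ℕ.* n)       ≈⟨ +-cong (sym (*-identityˡ _)) (fromℕ-* m n) ⟩
    1# * fromℕ n + fromℕ m * fromℕ n ≈⟨ sym (distribʳ _ _ _) ⟩
    (1# + fromℕ m) * fromℕ n        ∎

  fromℤ-⊖ : ∀ m n → fromℤ (m ⊖ n) ≈ fromℕ m - fromℕ n
  fromℤ-⊖ zero zero = sym (trans (+-identityˡ _) -0#≈0#)
  fromℤ-⊖ zero (suc n) = sym (+-identityˡ _)
  fromℤ-⊖ (suc m) zero = sym (trans (+-congˡ -0#≈0#) (+-identityʳ _))
  fromℤ-⊖ (suc m) (suc n) = begin
    fromℤ (suc m ⊖ suc n)                   ≡⟨ ≡.cong fromℤ (ℤ.[1+m]⊖[1+n]≡m⊖n m n) ⟩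
    fromℤ (m ⊖ n)                           ≈⟨ fromℤ-⊖ m n ⟩
    fromℕ m - fromℕ n                       ≈⟨ +-congʳ (sym (+-identityˡ _)) ⟩
    (0# + fromℕ m) - fromℕ n                ≈⟨ +-congʳ (+-congʳ (sym (-‿inverseʳ 1#))) ⟩
    ((1# - 1#) + fromℕ m) - fromℕ n         ≈⟨ +-congʳ (+-assoc _ _ _) ⟩
    (1# + (- 1# + fromℕ m)) - fromℕ n       ≈⟨ +-congʳ (+-congˡ (+-comm _ _)) ⟩
    (1# + (fromℕ m - 1#)) - fromℕ n         ≈⟨ +-congʳ (sym (+-assoc _ _ _)) ⟩
    ((1# + fromℕ m) - 1#) - fromℕ n         ≈⟨ +-assoc _ _ _ ⟩
    (1# + fromℕ m) + (- 1# - fromℕ n)       ≈⟨ +-congˡ (⁻¹-∙-comm 1# (fromℕ n)) ⟩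
    (1# + fromℕ m) - (1# + fromℕ n)         ∎

  fromℤ-+ : ∀ i j → fromℤ (i ℤ.+ j) ≈ fromℤ i + fromℤ j
  fromℤ-+ -[1+ m ] -[1+ n ] = begin
    - fromℕ (suc (suc (m ℕ.+ n)))     ≡⟨ ≡.cong (λ k → - fromℕ (suc k)) (≡.sym (ℕ.+-suc m n)) ⟩
    - fromℕ (suc m ℕ.+ suc n)         ≈⟨ -‿cong (fromℕ-+ (suc m) (suc n)) ⟩
    - (fromℕ (suc m) + fromℕ (suc n)) ≈⟨ sym (⁻¹-∙-comm _ _) ⟩
    - fromℕ (suc m) - fromℕ (suc n)   ∎
  fromℤ-+ -[1+ m ] (+ n) = trans (fromℤ-⊖ n (suc m)) (+-comm _ _)
  fromℤ-+ (+ m) -[1+ n ] = fromℤ-⊖ m (suc n)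
  fromℤ-+ (+ m) (+ n) = fromℕ-+ m n

  fromℤ-neg : ∀ i → fromℤ (ℤ.- i) ≈ - fromℤ i
  fromℤ-neg -[1+ n ] = sym (-‿involutive _)
  fromℤ-neg (+ zero) = sym -0#≈0#
  fromℤ-neg (+ suc n) = refl

  fromℤ-pos◃ : ∀ n → fromℤ (Sign.+ ℤ.◃ n) ≈ fromℕ n
  fromℤ-pos◃ zero = refl
  fromℤ-pos◃ (suc n) = refl

  fromℤ-neg◃ : ∀ n → fromℤ (Sign.- ℤ.◃ n) ≈ - fromℕ n
  fromℤ-neg◃ zero = sym -0#≈0#
  fromℤ-neg◃ (suc n) = refl

  fromℤ-* : ∀ i j → fromℤ (i ℤ.* j) ≈ fromℤ i * fromℤ j
  fromℤ-* (+ m) (+ n) = trans (fromℤ-pos◃ (m ℕ.* n)) (fromℕ-* m n)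
  fromℤ-* (+ m) -[1+ n ] =
    trans (fromℤ-neg◃ (m ℕ.* suc n)) (trans (-‿cong (fromℕ-* m (suc n))) (-‿distribʳ-* _ _))
  fromℤ-* -[1+ m ] (+ n) =
    trans (fromℤ-neg◃ (suc m ℕ.* n)) (trans (-‿cong (fromℕ-* (suc m) n)) (-‿distribˡ-* _ _))
  fromℤ-* -[1+ m ] -[1+ n ] = begin
    fromℤ (Sign.+ ℤ.◃ (suc m ℕ.* suc n)) ≈⟨ fromℤ-pos◃ (suc m ℕ.* suc n) ⟩
    fromℕ (suc m ℕ.* suc n)             ≈⟨ fromℕ-* (suc m) (suc n) ⟩
    M * N                               ≈⟨ sym (-‿involutive _) ⟩
    - - (M * N)                         ≈⟨ -‿cong (-‿distribˡ-* M N) ⟩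
    - (- M * N)                         ≈⟨ -‿distribʳ-* (- M) N ⟩
    - M * - N                           ∎
    where
    M = fromℕ (suc m)
    N = fromℕ (suc n)

  -- The coefficient map handed to the ring solver: fromℤ, except that 1 goes to 1# on the nose,
  -- so that 1# in a goal can be written as con (+ 1).
  ⟦_⟧ℤ : ℤ → Carrier
  ⟦ + 1 ⟧ℤ = 1#
  ⟦ i ⟧ℤ = fromℤ i

  ⟦⟧ℤ≈fromℤ : ∀ i → ⟦ i ⟧ℤ ≈ fromℤ i
  ⟦⟧ℤ≈fromℤ (+ 0) = refl
  ⟦⟧ℤ≈fromℤ (+ 1) = sym (+-identityʳ 1#)
  ⟦⟧ℤ≈fromℤ (+ suc (suc n)) = refl
  ⟦⟧ℤ≈fromℤ -[1+ n ] = refl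

  ⟦⟧ℤ-morphism : ℤ.+-*-rawRing ACR.-Raw-AlmostCommutative⟶ ACR.fromCommutativeRing R
  ⟦⟧ℤ-morphism = record
    { ⟦_⟧ = ⟦_⟧ℤ
    ; +-homo = λ i j → trans (⟦⟧ℤ≈fromℤ (i ℤ.+ j))
                             (trans (fromℤ-+ i j) (sym (+-cong (⟦⟧ℤ≈fromℤ i) (⟦⟧ℤ≈fromℤ j))))
    ; *-homo = λ i j → trans (⟦⟧ℤ≈fromℤ (i ℤ.* j))
                             (trans (fromℤ-* i j) (sym (*-cong (⟦⟧ℤ≈fromℤ i) (⟦⟧ℤ≈fromℤ j))))
    ; -‿homo = λ i → trans (⟦⟧ℤ≈fromℤ (ℤ.- i)) (trans (fromℤ-neg i) (-‿cong (sym (⟦⟧ℤ≈fromℤ i))))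
    ; 0-homo = refl
    ; 1-homo = refl
    }

  ⟦⟧ℤ-≈? : ∀ i j → Maybe (⟦ i ⟧ℤ ≈ ⟦ j ⟧ℤ)
  ⟦⟧ℤ-≈? i j with i ℤ.≟ j
  ... | yes i≡j = just (reflexive (≡.cong ⟦_⟧ℤ i≡j))
  ... | no _ = nothing

  open import Algebra.Solver.Ring ℤ.+-*-rawRing (ACR.fromCommutativeRing R) ⟦⟧ℤ-morphism ⟦⟧ℤ-≈?

  fromℕ-∸ : ∀ m n → m ℕ.≤ n → fromℕ (n ℕ.∸ m) ≈ fromℕ n - fromℕ m
  fromℕ-∸ m n m≤n = begin
    fromℕ (n ℕ.∸ m)                        ≈⟨ solve 2 (λ a b → a := (b :+ a) :- b) refl _ _ ⟩
    (fromℕ m + fromℕ (n ℕ.∸ m)) - fromℕ m ≈⟨ +-congʳ (sym (fromℕ-+ m (n ℕ.∸ m))) ⟩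
    fromℕ (m ℕ.+ (n ℕ.∸ m)) - fromℕ m     ≡⟨ ≡.cong (λ k → fromℕ k - fromℕ m) (ℕ.m+[n∸m]≡n m≤n) ⟩
    fromℕ n - fromℕ m                      ∎

  fromℤ-sub : ∀ m n → fromℤ (+ m ℤ.- + n) ≈ fromℕ m - fromℕ n
  fromℤ-sub m n = trans (reflexive (≡.cong fromℤ (ℤ.m-n≡m⊖n m n))) (fromℤ-⊖ m n)

  coeff-⊕ : ∀ p q n → coeff (p ⊕ q) n ≈ coeff p n + coeff q n
  coeff-⊕ [] q n = sym (+-identityˡ _)
  coeff-⊕ (x ∷ p) [] n = sym (+-identityʳ _)
  coeff-⊕ (x ∷ p) (y ∷ q) zero = refl
  coeff-⊕ (x ∷ p) (y ∷ q) (suc n) = coeff-⊕ p q n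

  coeff-scal : ∀ a p n → coeff (scal a p) n ≈ a * coeff p n
  coeff-scal a [] n = sym (zeroʳ a)
  coeff-scal a (x ∷ p) zero = refl
  coeff-scal a (x ∷ p) (suc n) = coeff-scal a p n

  eval : Poly → Carrier → Carrier
  eval [] t = 0#
  eval (x ∷ p) t = x + t * eval p t

  eval-congʳ : ∀ p {t t′} → t ≈ t′ → eval p t ≈ eval p t′
  eval-congʳ [] t≈t′ = refl
  eval-congʳ (x ∷ p) t≈t′ = +-congˡ (*-cong t≈t′ (eval-congʳ p t≈t′))

  eval-[] : ∀ p → p ≈ₚ [] → ∀ t → eval p t ≈ 0#
  eval-[] [] p≈0 t = refl
  eval-[] (x ∷ p) p≈0 t = begin
    x + t * eval p t ≈⟨ +-cong (p≈0 0) (*-congˡ (eval-[] p (λ n → p≈0 (suc n)) t)) ⟩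
    0# + t * 0#      ≈⟨ trans (+-identityˡ _) (zeroʳ t) ⟩
    0#               ∎

  eval-⊕ : ∀ p q t → eval (p ⊕ q) t ≈ eval p t + eval q t
  eval-⊕ [] q t = sym (+-identityˡ _)
  eval-⊕ (x ∷ p) [] t = sym (+-identityʳ _)
  eval-⊕ (x ∷ p) (y ∷ q) t = trans (+-congˡ (*-congˡ (eval-⊕ p q t)))
    (solve 5 (λ x y t P Q → x :+ y :+ t :* (P :+ Q) := x :+ t :* P :+ (y :+ t :* Q)) refl x y t (eval p t) (eval q t))

  eval-≈ₚ : ∀ p q → p ≈ₚ q → ∀ t → eval p t ≈ eval q t
  eval-≈ₚ [] q p≈q t = sym (eval-[] q (λ n → sym (p≈q n)) t)
  eval-≈ₚ (x ∷ p) [] p≈q t = eval-[] (x ∷ p) p≈q t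
  eval-≈ₚ (x ∷ p) (y ∷ q) p≈q t = +-cong (p≈q 0) (*-congˡ (eval-≈ₚ p q (λ n → p≈q (suc n)) t))

  eval-scal : ∀ a p t → eval (scal a p) t ≈ a * eval p t
  eval-scal a [] t = sym (zeroʳ a)
  eval-scal a (x ∷ p) t = trans (+-congˡ (*-congˡ (eval-scal a p t)))
    (solve 4 (λ a x t P → a :* x :+ t :* (a :* P) := a :* (x :+ t :* P)) refl a x t (eval p t))

  eval-⊛ : ∀ p q t → eval (p ⊛ q) t ≈ eval p t * eval q t
  eval-⊛ [] q t = sym (zeroˡ _)
  eval-⊛ (x ∷ p) q t = begin
    eval (scal x q ⊕ mulK (p ⊛ q)) t         ≈⟨ eval-⊕ (scal x q) (mulK (p ⊛ q)) t ⟩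
    eval (scal x q) t + (0# + t * eval (p ⊛ q) t)
      ≈⟨ +-cong (eval-scal x q t) (trans (+-identityˡ _) (*-congˡ (eval-⊛ p q t))) ⟩
    x * eval q t + t * (eval p t * eval q t)
      ≈⟨ solve 4 (λ x t P Q → x :* Q :+ t :* (P :* Q) := (x :+ t :* P) :* Q) refl x t (eval p t) (eval q t) ⟩
    (x + t * eval p t) * eval q t            ∎

  eval-pow : ∀ p n t → eval (pow p n) t ≈ eval p t ^ n
  eval-pow p zero t = trans (+-congˡ (zeroʳ t)) (+-identityʳ _)
  eval-pow p (suc n) t = trans (eval-⊛ p (pow p n) t) (*-congˡ (eval-pow p n t))

  eval-linear : ∀ a b t → eval (a ∷ b ∷ []) t ≈ a + t * b
  eval-linear a b t = +-congˡ (*-congˡ (trans (+-congˡ (zeroʳ t)) (+-identityʳ b)))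

  eval-compLin : ∀ α β p t → eval (compLin α β p) t ≈ eval p (α * t + β)
  eval-compLin α β [] t = refl
  eval-compLin α β (x ∷ p) t = begin
    eval ((x ∷ []) ⊕ (mulK (scal α q) ⊕ scal β q)) t
      ≈⟨ trans (eval-⊕ (x ∷ []) (mulK (scal α q) ⊕ scal β q) t) (+-congˡ (eval-⊕ (mulK (scal α q)) (scal β q) t)) ⟩
    (x + t * 0#) + ((0# + t * eval (scal α q) t) + eval (scal β q) t)
      ≈⟨ +-congˡ (+-cong (+-congˡ (*-congˡ (eval-scal α q t))) (eval-scal β q t)) ⟩
    (x + t * 0#) + ((0# + t * (α * eval q t)) + β * eval q t)
      ≈⟨ solve 5 (λ x t α β Q → (x :+ t :* con (+ 0)) :+ ((con (+ 0) :+ t :* (α :* Q)) :+ β :* Q)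
                             := x :+ (α :* t :+ β) :* Q) refl x t α β (eval q t) ⟩
    x + (α * t + β) * eval q t
      ≈⟨ +-congˡ (*-congˡ (eval-compLin α β p t)) ⟩
    x + (α * t + β) * eval p (α * t + β) ∎
    where q = compLin α β p

  eval-shift : ∀ a p t → eval (shift a p) t ≈ eval p (t + a)
  eval-shift a p t = trans (eval-compLin 1# a p t) (eval-congʳ p (+-congʳ (*-identityˡ t)))

  -- Synthetic division by k − r.
  quotient : Carrier → Poly → Poly
  quotient r [] = []
  quotient r (x ∷ []) = []
  quotient r (x ∷ y ∷ p) = eval (y ∷ p) r ∷ quotient r (y ∷ p)

  eval-quotient : ∀ r p t → eval p t ≈ eval p r + (t - r) * eval (quotient r p) t
  eval-quotient r [] t = solve 2 (λ t r → con (+ 0) := con (+ 0) :+ (t :- r) :* con (+ 0)) refl t r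
  eval-quotient r (x ∷ []) t =
    solve 3 (λ x t r → x :+ t :* con (+ 0) := (x :+ r :* con (+ 0)) :+ (t :- r) :* con (+ 0)) refl x t r
  eval-quotient r (x ∷ y ∷ p) t = begin
    x + t * eval (y ∷ p) t        ≈⟨ +-congˡ (*-congˡ (eval-quotient r (y ∷ p) t)) ⟩
    x + t * (P r + (t - r) * Q)
      ≈⟨ solve 5 (λ x t r Pr Q → x :+ t :* (Pr :+ (t :- r) :* Q) := (x :+ r :* Pr) :+ (t :- r) :* (Pr :+ t :* Q))
               refl x t r (P r) Q ⟩
    (x + r * P r) + (t - r) * (P r + t * Q) ∎
    where
    P = eval (y ∷ p)
    Q = eval (quotient r (y ∷ p)) t

  length-quotient : ∀ r x p → length (quotient r (x ∷ p)) ≡ length p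
  length-quotient r x [] = ≡.refl
  length-quotient r x (y ∷ p) = ≡.cong suc (length-quotient r y p)

  root∧quotient≈[]⇒≈[] : ∀ r p → eval p r ≈ 0# → quotient r p ≈ₚ [] → p ≈ₚ []
  root∧quotient≈[]⇒≈[] r [] _ _ n = refl
  root∧quotient≈[]⇒≈[] r (x ∷ []) root _ zero = trans (sym (trans (+-congˡ (zeroʳ r)) (+-identityʳ x))) root
  root∧quotient≈[]⇒≈[] r (x ∷ []) _ _ (suc n) = refl
  root∧quotient≈[]⇒≈[] r (x ∷ y ∷ p) root q≈0 zero = begin
    x                      ≈⟨ sym (+-identityʳ x) ⟩
    x + 0#                 ≈⟨ +-congˡ (sym (trans (*-congˡ (q≈0 0)) (zeroʳ r))) ⟩
    x + r * eval (y ∷ p) r ≈⟨ root ⟩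
    0#                     ∎
  root∧quotient≈[]⇒≈[] r (x ∷ y ∷ p) _ q≈0 (suc n) =
    root∧quotient≈[]⇒≈[] r (y ∷ p) (q≈0 0) (λ m → q≈0 (suc m)) n

  sumK-cong : ∀ N {f g} → (∀ i → i ℕ.< N → f i ≈ g i) → sumK N f ≈ sumK N g
  sumK-cong zero f≈g = refl
  sumK-cong (suc N) f≈g = +-cong (sumK-cong N (λ i i<N → f≈g i (ℕ.m<n⇒m<1+n i<N))) (f≈g N ℕ.≤-refl)

  sumK-zero : ∀ N {f} → (∀ i → i ℕ.< N → f i ≈ 0#) → sumK N f ≈ 0#
  sumK-zero zero f≈0 = refl
  sumK-zero (suc N) f≈0 =
    trans (+-cong (sumK-zero N (λ i i<N → f≈0 i (ℕ.m<n⇒m<1+n i<N))) (f≈0 N ℕ.≤-refl)) (+-identityˡ 0#)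

  sumK-single : ∀ N n {f} → n ℕ.< N → (∀ i → i ℕ.< N → ¬ i ≡ n → f i ≈ 0#) → sumK N f ≈ f n
  sumK-single (suc N) n n<N others with n ℕ.≟ N
  ... | yes ≡.refl = trans (+-congʳ (sumK-zero N (λ i i<N → others i (ℕ.m<n⇒m<1+n i<N) (ℕ.<⇒≢ i<N))))
                           (+-identityˡ _)
  ... | no n≢N = trans (+-cong (sumK-single N n (ℕ.≤∧≢⇒< (ℕ.≤-pred n<N) n≢N)
                                             (λ i i<N → others i (ℕ.m<n⇒m<1+n i<N)))
                               (others N ℕ.≤-refl (λ N≡n → n≢N (≡.sym N≡n))))
                       (+-identityʳ _)

  sumK-+ : ∀ N f g → sumK N (λ i → f i + g i) ≈ sumK N f + sumK N g
  sumK-+ zero f g = sym (+-identityˡ 0#)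
  sumK-+ (suc N) f g = trans (+-congʳ (sumK-+ N f g))
    (solve 4 (λ a b c d → (a :+ b) :+ (c :+ d) := (a :+ c) :+ (b :+ d)) refl (sumK N f) (sumK N g) (f N) (g N))

  sumK-distribˡ : ∀ N a f → sumK N (λ i → a * f i) ≈ a * sumK N f
  sumK-distribˡ zero a f = sym (zeroʳ a)
  sumK-distribˡ (suc N) a f = trans (+-congʳ (sumK-distribˡ N a f)) (sym (distribˡ a _ _))

  sumK-suc : ∀ N f → sumK (suc N) f ≈ f 0 + sumK N (λ i → f (suc i))
  sumK-suc zero f = trans (+-identityˡ _) (sym (+-identityʳ _))
  sumK-suc (suc N) f = trans (+-congʳ (sumK-suc N f)) (+-assoc _ _ _)

  sumK-split : ∀ L M f → sumK (L ℕ.+ M) f ≈ sumK L f + sumK M (λ i → f (L ℕ.+ i))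
  sumK-split zero M f = sym (+-identityˡ _)
  sumK-split (suc L) M f = begin
    sumK (suc (L ℕ.+ M)) f                                          ≈⟨ sumK-suc (L ℕ.+ M) f ⟩
    f 0 + sumK (L ℕ.+ M) (λ i → f (suc i))                          ≈⟨ +-congˡ (sumK-split L M (λ i → f (suc i))) ⟩
    f 0 + (sumK L (λ i → f (suc i)) + sumK M (λ i → f (suc L ℕ.+ i))) ≈⟨ sym (+-assoc _ _ _) ⟩
    (f 0 + sumK L (λ i → f (suc i))) + sumK M (λ i → f (suc L ℕ.+ i)) ≈⟨ +-congʳ (sym (sumK-suc L f)) ⟩
    sumK (suc L) f + sumK M (λ i → f (suc L ℕ.+ i))                   ∎

  sumK-comm : ∀ N M (f : ℕ → ℕ → Carrier) →
              sumK N (λ i → sumK M (λ j → f i j)) ≈ sumK M (λ j → sumK N (λ i → f i j))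
  sumK-comm zero M f = sym (sumK-zero M (λ _ _ → refl))
  sumK-comm (suc N) M f = trans (+-congʳ (sumK-comm N M f)) (sym (sumK-+ M (λ j → sumK N (λ i → f i j)) (f N)))

  sumK-reverse : ∀ J g → sumK (suc J) (λ i → g (J ℕ.∸ i)) ≈ sumK (suc J) g
  sumK-reverse zero g = refl
  sumK-reverse (suc J) g = begin
    sumK (suc J) (λ i → g (suc J ℕ.∸ i)) + g (J ℕ.∸ J)
      ≈⟨ +-cong (sumK-cong (suc J) (λ i i<1+J → reflexive (≡.cong g (ℕ.+-∸-assoc 1 (ℕ.≤-pred i<1+J)))))
                (reflexive (≡.cong g (ℕ.n∸n≡0 J))) ⟩
    sumK (suc J) (λ i → g (suc (J ℕ.∸ i))) + g 0 ≈⟨ +-congʳ (sumK-reverse J (λ i → g (suc i))) ⟩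
    sumK (suc J) (λ i → g (suc i)) + g 0         ≈⟨ +-comm _ _ ⟩
    g 0 + sumK (suc J) (λ i → g (suc i))         ≈⟨ sym (sumK-suc (suc J) g) ⟩
    sumK (suc (suc J)) g                         ∎

  eval-sumₚ : ∀ N F t → eval (sumₚ N F) t ≈ sumK N (λ i → eval (F i) t)
  eval-sumₚ zero F t = refl
  eval-sumₚ (suc N) F t = trans (eval-⊕ (sumₚ N F) (F N) t) (+-congʳ (eval-sumₚ N F t))

  eval-adjoint : ∀ J a x t →
    eval (adjoint J a x) t ≈ sumK (suc J) (λ i → eval (a i) (t - fromℕ i) * eval x (t - fromℕ i))
  eval-adjoint J a x t = trans (eval-sumₚ (suc J) _ t) (sumK-cong (suc J) (λ i _ →
     trans (eval-shift (- fromℕ i) (a i ⊛ x) t) (eval-⊛ (a i) x _)))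

  eval-bpoly : ∀ J a l t → eval (bpoly J a l) t ≈
    sumK (suc J ℕ.∸ l) (λ i → fromℕ ((l ℕ.+ i) C l) * eval (a (J ℕ.∸ (l ℕ.+ i))) (t + fromℤ (+ (l ℕ.+ i) ℤ.- + J)))
  eval-bpoly J a l t = trans (eval-sumₚ (suc J ℕ.∸ l) _ t) (sumK-cong (suc J ℕ.∸ l) (λ i _ →
     trans (eval-scal _ (shift _ (a (J ℕ.∸ (l ℕ.+ i)))) t) (*-congˡ (eval-shift _ (a (J ℕ.∸ (l ℕ.+ i))) t))))

  combination : ℕ → (ℕ → Bool) → (ℕ → Poly) → (ℕ → Carrier) → Poly
  combination N b F w = sumIf N b (λ i → scal (w i) (F i))

  eval-combination : ∀ N b F w t →
    eval (combination N b F w) t ≈ sumK N (λ i → w i * (if b i then eval (F i) t else 0#))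
  eval-combination N b F w t = trans (eval-sumₚ N _ t) (sumK-cong N (λ i _ → term (b i)))
    where
    term : ∀ {i} bᵢ → eval (if bᵢ then scal (w i) (F i) else []) t ≈ w i * (if bᵢ then eval (F i) t else 0#)
    term true = eval-scal _ (F _) t
    term false = sym (zeroʳ _)

  eval-combination-linear : ∀ N b F w₁ w₂ e t →
    eval (combination N b F (λ i → w₁ i + e * w₂ i)) t ≈
    eval (combination N b F w₁) t + e * eval (combination N b F w₂) t
  eval-combination-linear N b F w₁ w₂ e t = begin
    eval (combination N b F (λ i → w₁ i + e * w₂ i)) t     ≈⟨ eval-combination N b F _ t ⟩
    sumK N (λ i → (w₁ i + e * w₂ i) * y i)
      ≈⟨ sumK-cong N (λ i _ → trans (distribʳ _ _ _) (+-congˡ (*-assoc _ _ _))) ⟩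
    sumK N (λ i → w₁ i * y i + e * (w₂ i * y i))           ≈⟨ trans (sumK-+ N _ _) (+-congˡ (sumK-distribˡ N e _)) ⟩
    sumK N (λ i → w₁ i * y i) + e * sumK N (λ i → w₂ i * y i)
      ≈⟨ sym (+-cong (eval-combination N b F w₁ t) (*-congˡ (eval-combination N b F w₂ t))) ⟩
    eval (combination N b F w₁) t + e * eval (combination N b F w₂) t ∎
    where
    y : ℕ → Carrier
    y i = if b i then eval (F i) t else 0#

  eval-combination-0 : ∀ N b F t → eval (combination N b F (λ _ → 0#)) t ≈ 0#
  eval-combination-0 N b F t = trans (eval-combination N b F _ t) (sumK-zero N (λ _ _ → zeroˡ _))

  δ : ℕ → ℕ → Carrier
  δ n i with i ℕ.≟ n
  ... | yes _ = 1#
  ... | no _ = 0#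

  eval-combination-δ : ∀ N b F n t → n ℕ.< N → b n ≡ true → eval (combination N b F (δ n)) t ≈ eval (F n) t
  eval-combination-δ N b F n t n<N bₙ = trans (eval-combination N b F (δ n) t) (trans (sumK-single N n n<N off) on)
    where
    off : ∀ i → i ℕ.< N → ¬ i ≡ n → δ n i * (if b i then eval (F i) t else 0#) ≈ 0#
    off i _ i≢n with i ℕ.≟ n
    ... | yes i≡n = ⊥-elim (i≢n i≡n)
    ... | no _ = zeroˡ _
    on : δ n n * (if b n then eval (F n) t else 0#) ≈ eval (F n) t
    on with n ℕ.≟ n
    ... | no n≢n = ⊥-elim (n≢n ≡.refl)
    ... | yes _ rewrite bₙ = *-identityˡ _

  -- Degree bounds

  record Top (p : Poly) (n : ℕ) (c : Carrier) : Set ℓ where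
    constructor top
    field
      above : ∀ m → n ℕ.< m → coeff p m ≈ 0#
      at : coeff p n ≈ c
  open Top public

  Top-resp : ∀ {p n c c′} → c ≈ c′ → Top p n c → Top p n c′
  Top-resp c≈c′ (top above at) = top above (trans at c≈c′)

  Top-≈ₚ : ∀ {p q n c} → p ≈ₚ q → Top p n c → Top q n c
  Top-≈ₚ p≈q (top above at) = top (λ m n<m → trans (sym (p≈q m)) (above m n<m)) (trans (sym (p≈q _)) at)

  Top-weaken : ∀ {p n c m} → Top p n c → n ℕ.< m → Top p m 0#
  Top-weaken (top above at) n<m = top (λ k m<k → above k (ℕ.<-trans n<m m<k)) (above _ n<m)

  Top-[] : ∀ p n → p ≈ₚ [] → Top p n 0#
  Top-[] p n p≈0 = top (λ m _ → p≈0 m) (p≈0 n)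

  Top⇒≈[] : ∀ {p} → Top p 0 0# → p ≈ₚ []
  Top⇒≈[] (top above at) zero = at
  Top⇒≈[] (top above at) (suc m) = above (suc m) (s≤s z≤n)

  Top-const : ∀ x → Top (x ∷ []) 0 x
  Top-const x = top (λ { (suc m) _ → refl }) refl

  Top-∷ : ∀ {x p n c} → Top (x ∷ p) (suc n) c → Top p n c
  Top-∷ (top above at) = top (λ m n<m → above (suc m) (s≤s n<m)) at

  Top-∷-0 : ∀ {x p c} → Top (x ∷ p) 0 c → p ≈ₚ []
  Top-∷-0 (top above at) m = above (suc m) (s≤s z≤n)

  Top-⊕ : ∀ {p q n c e} → Top p n c → Top q n e → Top (p ⊕ q) n (c + e)
  Top-⊕ {p} {q} (top above at) (top above′ at′) =
    top (λ m n<m → trans (coeff-⊕ p q m) (trans (+-cong (above m n<m) (above′ m n<m)) (+-identityˡ 0#)))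
        (trans (coeff-⊕ p q _) (+-cong at at′))

  Top-scal : ∀ {p n c} a → Top p n c → Top (scal a p) n (a * c)
  Top-scal {p} a (top above at) =
    top (λ m n<m → trans (coeff-scal a p m) (trans (*-congˡ (above m n<m)) (zeroʳ a)))
        (trans (coeff-scal a p _) (*-congˡ at))

  Top-mulK : ∀ {p n c} → Top p n c → Top (mulK p) (suc n) c
  Top-mulK (top above at) = top (λ { (suc m) (s≤s n<m) → above m n<m }) at

  ⊕-[] : ∀ p q → p ≈ₚ [] → q ≈ₚ [] → p ⊕ q ≈ₚ []
  ⊕-[] p q p≈0 q≈0 n = trans (coeff-⊕ p q n) (trans (+-cong (p≈0 n) (q≈0 n)) (+-identityˡ 0#))

  scal-[] : ∀ a p → p ≈ₚ [] → scal a p ≈ₚ []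
  scal-[] a p p≈0 n = trans (coeff-scal a p n) (trans (*-congˡ (p≈0 n)) (zeroʳ a))

  mulK-[] : ∀ {p} → p ≈ₚ [] → mulK p ≈ₚ []
  mulK-[] p≈0 zero = refl
  mulK-[] p≈0 (suc n) = p≈0 n

  ⊛-[]ˡ : ∀ p q → p ≈ₚ [] → p ⊛ q ≈ₚ []
  ⊛-[]ˡ [] q p≈0 n = refl
  ⊛-[]ˡ (x ∷ p) q p≈0 n = begin
    coeff (scal x q ⊕ mulK (p ⊛ q)) n       ≈⟨ coeff-⊕ (scal x q) (mulK (p ⊛ q)) n ⟩
    coeff (scal x q) n + coeff (mulK (p ⊛ q)) n
      ≈⟨ +-cong (trans (coeff-scal x q n) (*-congʳ (p≈0 0))) (mulK-[] (⊛-[]ˡ p q (λ m → p≈0 (suc m))) n) ⟩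
    0# * coeff q n + 0#                     ≈⟨ trans (+-identityʳ _) (zeroˡ _) ⟩
    0#                                      ∎

  ⊛-[]ʳ : ∀ p q → q ≈ₚ [] → p ⊛ q ≈ₚ []
  ⊛-[]ʳ [] q q≈0 n = refl
  ⊛-[]ʳ (x ∷ p) q q≈0 n = begin
    coeff (scal x q ⊕ mulK (p ⊛ q)) n       ≈⟨ coeff-⊕ (scal x q) (mulK (p ⊛ q)) n ⟩
    coeff (scal x q) n + coeff (mulK (p ⊛ q)) n
      ≈⟨ +-cong (trans (coeff-scal x q n) (*-congˡ (q≈0 n))) (mulK-[] (⊛-[]ʳ p q q≈0) n) ⟩
    x * 0# + 0#                             ≈⟨ trans (+-identityʳ _) (zeroʳ x) ⟩
    0#                                      ∎

  Top-⊛ : ∀ {p q a b c e} → Top p a c → Top q b e → Top (p ⊛ q) (a ℕ.+ b) (c * e)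
  Top-⊛ {[]} {a = a} {b} (top above at) q-top = Top-resp (trans (sym (zeroˡ _)) (*-congʳ at)) (Top-[] [] (a ℕ.+ b) λ _ → refl)
  Top-⊛ {x ∷ p} {q} {zero} {b} p-top q-top =
    Top-resp (trans (+-identityʳ _) (*-congʳ (at p-top)))
      (Top-⊕ (Top-scal x q-top) (Top-[] (mulK (p ⊛ q)) b (mulK-[] (⊛-[]ˡ p q (Top-∷-0 p-top)))))
  Top-⊛ {x ∷ p} {a = suc a} {b} p-top q-top =
    Top-resp (+-identityˡ _)
      (Top-⊕ (Top-weaken (Top-scal x q-top) (s≤s (ℕ.m≤n+m b a))) (Top-mulK (Top-⊛ (Top-∷ p-top) q-top)))

  Top-shift : ∀ a {p n c} → Top p n c → Top (shift a p) n c
  Top-shift a {[]} p-top = p-top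
  Top-shift a {x ∷ p} {zero} p-top =
    Top-resp (trans (+-identityʳ x) (at p-top))
      (Top-⊕ (Top-const x) (Top-[] (mulK (scal 1# S) ⊕ scal a S) 0
        (⊕-[] (mulK (scal 1# S)) (scal a S) (mulK-[] {scal 1# S} (scal-[] 1# S S≈0)) (scal-[] a S S≈0))))
    where
    S = shift a p
    S≈0 = Top⇒≈[] (Top-shift a (Top-[] p 0 (Top-∷-0 p-top)))
  Top-shift a {x ∷ p} {suc n} {c} p-top =
    Top-resp (trans (+-identityˡ _) (trans (+-identityʳ _) (*-identityˡ c)))
      (Top-⊕ (Top-weaken (Top-const x) (s≤s z≤n))
             (Top-⊕ (Top-mulK (Top-scal 1# S-top)) (Top-weaken (Top-scal a S-top) (ℕ.n<1+n n))))
    where S-top = Top-shift a (Top-∷ p-top)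

  coeff-shift-subleading : ∀ a {p} n {c} → Top p (suc n) c →
    coeff (shift a p) n ≈ coeff p n + fromℕ (suc n) * a * c
  coeff-shift-subleading a {[]} n (top above at) =
    sym (trans (+-congˡ (trans (*-congˡ (sym at)) (zeroʳ _))) (+-identityˡ 0#))
  coeff-shift-subleading a {x ∷ p} zero {c} p-top = begin
    coeff ((x ∷ []) ⊕ (mulK (scal 1# S) ⊕ scal a S)) 0
      ≈⟨ trans (coeff-⊕ (x ∷ []) (mulK (scal 1# S) ⊕ scal a S) 0) (+-congˡ (coeff-⊕ (mulK (scal 1# S)) (scal a S) 0)) ⟩
    x + (0# + coeff (scal a S) 0)
      ≈⟨ +-congˡ (+-congˡ (trans (coeff-scal a S 0) (*-congˡ (at (Top-shift a (Top-∷ p-top)))))) ⟩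
    x + (0# + a * c)
      ≈⟨ solve 3 (λ x a c → x :+ (con (+ 0) :+ a :* c) := x :+ (con (+ 1) :+ con (+ 0)) :* a :* c) refl x a c ⟩
    x + (1# + 0#) * a * c ∎
    where S = shift a p
  coeff-shift-subleading a {x ∷ p} (suc n) {c} p-top = begin
    coeff ((x ∷ []) ⊕ (mulK (scal 1# S) ⊕ scal a S)) (suc n)
      ≈⟨ trans (coeff-⊕ (x ∷ []) (mulK (scal 1# S) ⊕ scal a S) (suc n))
               (+-congˡ (coeff-⊕ (mulK (scal 1# S)) (scal a S) (suc n))) ⟩
    0# + (coeff (scal 1# S) n + coeff (scal a S) (suc n))
      ≈⟨ +-congˡ (+-cong (trans (coeff-scal 1# S n) (*-congˡ (coeff-shift-subleading a n (Top-∷ p-top))))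
                         (trans (coeff-scal a S (suc n)) (*-congˡ (at (Top-shift a (Top-∷ p-top)))))) ⟩
    0# + (1# * (coeff p n + fromℕ (suc n) * a * c) + a * c)
      ≈⟨ solve 4 (λ C k a c → con (+ 0) :+ (con (+ 1) :* (C :+ k :* a :* c) :+ a :* c) := C :+ (con (+ 1) :+ k) :* a :* c)
               refl (coeff p n) (fromℕ (suc n)) a c ⟩
    coeff p n + (1# + fromℕ (suc n)) * a * c ∎
    where S = shift a p

  -- Forward differences and Newton's formula

  Δ : Poly → Poly
  Δ p = shift 1# p ⊕ scal (- 1#) p

  Δ^ : ℕ → Poly → Poly
  Δ^ zero p = p
  Δ^ (suc l) p = Δ (Δ^ l p)

  eval-Δ : ∀ p t → eval (Δ p) t ≈ eval p (t + 1#) - eval p t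
  eval-Δ p t = begin
    eval (shift 1# p ⊕ scal (- 1#) p) t           ≈⟨ eval-⊕ (shift 1# p) (scal (- 1#) p) t ⟩
    eval (shift 1# p) t + eval (scal (- 1#) p) t  ≈⟨ +-cong (eval-shift 1# p t) (eval-scal (- 1#) p t) ⟩
    eval p (t + 1#) + - 1# * eval p t             ≈⟨ +-congˡ (solve 1 (λ a → :- con (+ 1) :* a := :- a) refl _) ⟩
    eval p (t + 1#) - eval p t                    ∎

  Top-Δ : ∀ {p} n {c} → Top p (suc n) c → Top (Δ p) n (fromℕ (suc n) * c)
  Top-Δ {p} n {c} p-top = top above-n at-n
    where
    difference-top = Top-⊕ (Top-shift 1# p-top) (Top-scal (- 1#) p-top)
    above-n : ∀ m → n ℕ.< m → coeff (Δ p) m ≈ 0#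
    above-n m n<m with m ℕ.≟ suc n
    ... | yes ≡.refl = trans (at difference-top) (solve 1 (λ c → c :+ :- con (+ 1) :* c := con (+ 0)) refl c)
    ... | no m≢1+n = above difference-top m (ℕ.≤∧≢⇒< n<m (λ 1+n≡m → m≢1+n (≡.sym 1+n≡m)))
    at-n : coeff (Δ p) n ≈ fromℕ (suc n) * c
    at-n = begin
      coeff (Δ p) n                                    ≈⟨ coeff-⊕ (shift 1# p) (scal (- 1#) p) n ⟩
      coeff (shift 1# p) n + coeff (scal (- 1#) p) n   ≈⟨ +-cong (coeff-shift-subleading 1# n p-top) (coeff-scal (- 1#) p n) ⟩
      (coeff p n + fromℕ (suc n) * 1# * c) + - 1# * coeff p n
        ≈⟨ solve 3 (λ C k c → (C :+ k :* con (+ 1) :* c) :+ :- con (+ 1) :* C := k :* c) refl (coeff p n) (fromℕ (suc n)) c ⟩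
      fromℕ (suc n) * c                                ∎

  Δ-const : ∀ {p c} → Top p 0 c → Δ p ≈ₚ []
  Δ-const {c = c} p-top = Top⇒≈[] (Top-resp (solve 1 (λ c → c :+ :- con (+ 1) :* c := con (+ 0)) refl c)
    (Top-⊕ (Top-shift 1# p-top) (Top-scal (- 1#) p-top)))

  fall-vanishes : ∀ {j l} → j ℕ.< l → fall (fromℕ j) l ≈ 0#
  fall-vanishes {j} {suc l} (s≤s j≤l) with ℕ.m≤n⇒m<n∨m≡n j≤l
  ... | inj₁ j<l = trans (*-congʳ (fall-vanishes j<l)) (zeroˡ _)
  ... | inj₂ ≡.refl = trans (*-congˡ (-‿inverseʳ _)) (zeroʳ _)

  negative-degree-degenerate : ∀ J a n → ¬ Nondegenerated J a -[1+ n ]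
  negative-degree-degenerate J a n nondegenerated = nondegenerated 0 (sumK-zero (suc J) vanishes)
    where
    vanishes : ∀ l → l ℕ.< suc J → coeffℤ (bpoly J a l) (-[1+ n ] ℤ.+ + l) * fall (fromℕ 0) l ≈ 0#
    vanishes zero _ = zeroˡ _
    vanishes (suc l) _ = trans (*-congˡ (fall-vanishes {0} {suc l} (s≤s z≤n))) (zeroʳ _)

  Top-Δ^ : ∀ l k {p c} → Top p (l ℕ.+ k) c → Top (Δ^ l p) k (c * fall (fromℕ (l ℕ.+ k)) l)
  Top-Δ^ zero k p-top = Top-resp (sym (*-identityʳ _)) p-top
  Top-Δ^ (suc l) k {p} {c} p-top = Top-resp lead (Top-Δ k (Top-Δ^ l (suc k) p-top′))
    where
    p-top′ : Top p (l ℕ.+ suc k) c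
    p-top′ = ≡.subst (λ n → Top p n c) (≡.sym (ℕ.+-suc l k)) p-top
    F = fromℕ (suc l ℕ.+ k)
    F-l : F - fromℕ l ≈ fromℕ (suc k)
    F-l = begin
      F - fromℕ l                            ≡⟨ ≡.cong (λ n → fromℕ n - fromℕ l) (≡.sym (ℕ.+-suc l k)) ⟩
      fromℕ (l ℕ.+ suc k) - fromℕ l          ≈⟨ +-congʳ (fromℕ-+ l (suc k)) ⟩
      (fromℕ l + fromℕ (suc k)) - fromℕ l    ≈⟨ solve 2 (λ a b → (a :+ b) :- a := b) refl (fromℕ l) (fromℕ (suc k)) ⟩
      fromℕ (suc k)                          ∎
    lead : fromℕ (suc k) * (c * fall (fromℕ (l ℕ.+ suc k)) l) ≈ c * (fall F l * (F - fromℕ l))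
    lead = begin
      fromℕ (suc k) * (c * fall (fromℕ (l ℕ.+ suc k)) l)
        ≡⟨ ≡.cong (λ n → fromℕ (suc k) * (c * fall (fromℕ n) l)) (ℕ.+-suc l k) ⟩
      fromℕ (suc k) * (c * fall F l) ≈⟨ solve 3 (λ a b d → a :* (b :* d) := b :* (d :* a)) refl _ c _ ⟩
      c * (fall F l * fromℕ (suc k)) ≈⟨ *-congˡ (*-congˡ (sym F-l)) ⟩
      c * (fall F l * (F - fromℕ l)) ∎

  Δ^-vanishes : ∀ {p k c l} → Top p k c → k ℕ.< l → Δ^ l p ≈ₚ []
  Δ^-vanishes {p} {k} {c} {suc l} p-top (s≤s k≤l) with ℕ.m≤n⇒m<n∨m≡n k≤l
  ... | inj₁ k<l = Δ-const (Top-[] (Δ^ l p) 0 (Δ^-vanishes p-top k<l))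
  ... | inj₂ ≡.refl = Δ-const (Top-Δ^ k 0 (≡.subst (λ n → Top p n c) (≡.sym (ℕ.+-identityʳ k)) p-top))

  Top-sumₚ : ∀ N {F n cs} → (∀ i → i ℕ.< N → Top (F i) n (cs i)) → Top (sumₚ N F) n (sumK N cs)
  Top-sumₚ zero F-top = top (λ _ _ → refl) refl
  Top-sumₚ (suc N) F-top = Top-⊕ (Top-sumₚ N (λ i i<N → F-top i (ℕ.m<n⇒m<1+n i<N))) (F-top N ℕ.≤-refl)

  Top-pow-linear : ∀ b n → Top (pow (b ∷ 1# ∷ []) n) n 1#
  Top-pow-linear b zero = Top-const 1#
  Top-pow-linear b (suc n) =
    Top-resp (*-identityˡ 1#) (Top-⊛ {b ∷ 1# ∷ []} {a = 1} linear-top (Top-pow-linear b n))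
    where
    linear-top : Top (b ∷ 1# ∷ []) 1 1#
    linear-top = top (λ { (suc zero) (s≤s ()) ; (suc (suc m)) _ → refl }) refl

  monomial : ℕ → Poly
  monomial zero = 1# ∷ []
  monomial (suc n) = mulK (monomial n)

  eval-monomial : ∀ n t → eval (monomial n) t ≈ t ^ n
  eval-monomial zero t = trans (+-congˡ (zeroʳ t)) (+-identityʳ 1#)
  eval-monomial (suc n) t = trans (+-identityˡ _) (*-congˡ (eval-monomial n t))

  coeff-monomial-≢ : ∀ n i → ¬ i ≡ n → coeff (monomial n) i ≈ 0#
  coeff-monomial-≢ zero zero i≢n = ⊥-elim (i≢n ≡.refl)
  coeff-monomial-≢ zero (suc i) i≢n = refl
  coeff-monomial-≢ (suc n) zero i≢n = refl
  coeff-monomial-≢ (suc n) (suc i) i≢n = coeff-monomial-≢ n i (λ i≡n → i≢n (≡.cong suc i≡n))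

  Top-monomial : ∀ n → Top (monomial n) n 1#
  Top-monomial n = top (λ m n<m → coeff-monomial-≢ n m (λ m≡n → ℕ.<⇒≢ n<m (≡.sym m≡n))) (at-n n)
    where
    at-n : ∀ n → coeff (monomial n) n ≈ 1#
    at-n zero = refl
    at-n (suc n) = at-n n

  eval-newton : ∀ p N j → j ℕ.≤ N → ∀ s →
    eval p (s + fromℕ j) ≈ sumK (suc N) (λ l → fromℕ (j C l) * eval (Δ^ l p) s)
  eval-newton p N zero _ s = begin
    eval p (s + 0#)                    ≈⟨ eval-congʳ p (+-identityʳ s) ⟩
    eval p s                           ≈⟨ solve 1 (λ a → a := (con (+ 1) :+ con (+ 0)) :* a :+ con (+ 0)) refl _ ⟩
    (1# + 0#) * eval p s + 0#          ≈⟨ +-congˡ (sym (sumK-zero N (λ _ _ → zeroˡ _))) ⟩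
    (1# + 0#) * eval p s + sumK N (λ l → fromℕ (0 C suc l) * eval (Δ^ (suc l) p) s) ≈⟨ sym (sumK-suc N _) ⟩
    sumK (suc N) (λ l → fromℕ (0 C l) * eval (Δ^ l p) s) ∎
  eval-newton p N (suc j) 1+j≤N s = begin
    eval p (s + (1# + fromℕ j))                  ≈⟨ eval-congʳ p (sym (+-assoc s 1# _)) ⟩
    eval p ((s + 1#) + fromℕ j)                  ≈⟨ eval-newton p N j (ℕ.<⇒≤ 1+j≤N) (s + 1#) ⟩
    sumK (suc N) (λ l → B l * eval (Δ^ l p) (s + 1#))
      ≈⟨ sumK-cong (suc N) (λ l _ → trans (*-congˡ (step l)) (distribˡ _ _ _)) ⟩
    sumK (suc N) (λ l → B l * E l + B l * E (suc l)) ≈⟨ sumK-+ (suc N) _ _ ⟩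
    sumK (suc N) (λ l → B l * E l) + sumK (suc N) (λ l → B l * E (suc l))
      ≈⟨ +-cong (sumK-suc N _) (+-congˡ (trans (*-congʳ (reflexive (≡.cong fromℕ (k>n⇒nCk≡0 1+j≤N)))) (zeroˡ _))) ⟩
    (B 0 * E 0 + sumK N (λ l → B (suc l) * E (suc l))) + (sumK N (λ l → B l * E (suc l)) + 0#)
      ≈⟨ solve 3 (λ a b c → (a :+ b) :+ (c :+ con (+ 0)) := a :+ (c :+ b)) refl _ _ _ ⟩
    B 0 * E 0 + (sumK N (λ l → B l * E (suc l)) + sumK N (λ l → B (suc l) * E (suc l)))
      ≈⟨ +-congˡ (sym (sumK-+ N _ _)) ⟩
    B 0 * E 0 + sumK N (λ l → B l * E (suc l) + B (suc l) * E (suc l))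
      ≈⟨ +-congˡ (sumK-cong N (λ l _ → trans (sym (distribʳ _ _ _)) (*-congʳ (pascal l)))) ⟩
    B 0 * E 0 + sumK N (λ l → fromℕ (suc j C suc l) * E (suc l)) ≈⟨ sym (sumK-suc N _) ⟩
    sumK (suc N) (λ l → fromℕ (suc j C l) * eval (Δ^ l p) s) ∎
    where
    B E : ℕ → Carrier
    B l = fromℕ (j C l)
    E l = eval (Δ^ l p) s
    step : ∀ l → eval (Δ^ l p) (s + 1#) ≈ E l + E (suc l)
    step l = trans (solve 2 (λ a b → a := b :+ (a :- b)) refl _ _) (+-congˡ (sym (eval-Δ (Δ^ l p) s)))
    pascal : ∀ l → B l + B (suc l) ≈ fromℕ (suc j C suc l)
    pascal l = trans (sym (fromℕ-+ (j C l) (j C suc l))) (reflexive (≡.cong fromℕ (nCk+nC[k+1]≡[n+1]C[k+1] j l)))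

  -- Reindex i ↦ J − i and expand x(t − J + j) by Newton's formula.
  eval-adjoint-Δ : ∀ J a x t →
    eval (adjoint J a x) t ≈ sumK (suc J) (λ l → eval (bpoly J a l) t * eval (Δ^ l x) (t - fromℕ J))
  eval-adjoint-Δ J a x t = begin
    eval (adjoint J a x) t                                       ≈⟨ eval-adjoint J a x t ⟩
    sumK (suc J) g                                               ≈⟨ sym (sumK-reverse J g) ⟩
    sumK (suc J) (λ j → g (J ℕ.∸ j))
      ≈⟨ sumK-cong (suc J) (λ j j<1+J → reindex j (ℕ.≤-pred j<1+J)) ⟩
    sumK (suc J) (λ j → A j * eval x (s + fromℕ j))
      ≈⟨ sumK-cong (suc J) (λ j j<1+J → *-congˡ (eval-newton x J j (ℕ.≤-pred j<1+J) s)) ⟩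
    sumK (suc J) (λ j → A j * sumK (suc J) (λ l → fromℕ (j C l) * E l))
      ≈⟨ sumK-cong (suc J) (λ j _ → sym (sumK-distribˡ (suc J) (A j) _)) ⟩
    sumK (suc J) (λ j → sumK (suc J) (λ l → A j * (fromℕ (j C l) * E l))) ≈⟨ sumK-comm (suc J) (suc J) _ ⟩
    sumK (suc J) (λ l → sumK (suc J) (λ j → A j * (fromℕ (j C l) * E l)))
      ≈⟨ sumK-cong (suc J) (λ l l<1+J → collect l (ℕ.≤-pred l<1+J)) ⟩
    sumK (suc J) (λ l → eval (bpoly J a l) t * E l) ∎
    where
    s = t - fromℕ J
    g A E : ℕ → Carrier
    g i = eval (a i) (t - fromℕ i) * eval x (t - fromℕ i)
    A j = eval (a (J ℕ.∸ j)) (t + fromℤ (+ j ℤ.- + J))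
    E l = eval (Δ^ l x) s
    reindex : ∀ j → j ℕ.≤ J → g (J ℕ.∸ j) ≈ A j * eval x (s + fromℕ j)
    reindex j j≤J = *-cong (eval-congʳ (a (J ℕ.∸ j)) (+-congˡ (trans -[J-j] (sym (fromℤ-sub j J)))))
                           (eval-congʳ x (trans (+-congˡ -[J-j]) (solve 3 (λ t a b → t :+ (b :- a) := (t :- a) :+ b) refl t _ _)))
      where
      -[J-j] : - fromℕ (J ℕ.∸ j) ≈ fromℕ j - fromℕ J
      -[J-j] = trans (-‿cong (fromℕ-∸ j J j≤J)) (solve 2 (λ a b → :- (a :- b) := b :- a) refl _ _)
    collect : ∀ l → l ℕ.≤ J → sumK (suc J) (λ j → A j * (fromℕ (j C l) * E l)) ≈ eval (bpoly J a l) t * E l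
    collect l l≤J = begin
      sumK (suc J) (λ j → A j * (fromℕ (j C l) * E l))
        ≈⟨ sumK-cong (suc J) (λ j _ → solve 3 (λ a b c → a :* (b :* c) := c :* (b :* a)) refl _ _ _) ⟩
      sumK (suc J) (λ j → E l * f j)                  ≈⟨ sumK-distribˡ (suc J) (E l) f ⟩
      E l * sumK (suc J) f
        ≡⟨ ≡.cong (λ n → E l * sumK n f) (≡.sym (ℕ.m+[n∸m]≡n (ℕ.m≤n⇒m≤1+n l≤J))) ⟩
      E l * sumK (l ℕ.+ (suc J ℕ.∸ l)) f              ≈⟨ *-congˡ (sumK-split l (suc J ℕ.∸ l) f) ⟩
      E l * (sumK l f + sumK (suc J ℕ.∸ l) (λ i → f (l ℕ.+ i)))
        ≈⟨ *-congˡ (+-congʳ (sumK-zero l λ j j<l →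
             trans (*-congʳ (reflexive (≡.cong fromℕ (k>n⇒nCk≡0 j<l)))) (zeroˡ _))) ⟩
      E l * (0# + sumK (suc J ℕ.∸ l) (λ i → f (l ℕ.+ i)))
        ≈⟨ trans (*-congˡ (+-identityˡ _)) (*-comm _ _) ⟩
      sumK (suc J ℕ.∸ l) (λ i → f (l ℕ.+ i)) * E l    ≈⟨ *-congʳ (sym (eval-bpoly J a l t)) ⟩
      eval (bpoly J a l) t * E l                      ∎
      where
      f : ℕ → Carrier
      f j = fromℕ (j C l) * A j

  -- Signs and the symmetry of power-partible operators

  sgn : ℕ → Carrier
  sgn n = negOnePow (+ n)

  sgn-suc : ∀ n → sgn (suc n) ≈ - sgn n
  sgn-suc n rewrite evenℕ-suc n with evenℕ n
  ... | true = refl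
  ... | false = sym (-‿involutive 1#)

  sgn-+ : ∀ m n → sgn (m ℕ.+ n) ≈ sgn m * sgn n
  sgn-+ zero n = sym (*-identityˡ _)
  sgn-+ (suc m) n = begin
    sgn (suc m ℕ.+ n)     ≈⟨ sgn-suc (m ℕ.+ n) ⟩
    - sgn (m ℕ.+ n)       ≈⟨ -‿cong (sgn-+ m n) ⟩
    - (sgn m * sgn n)     ≈⟨ -‿distribˡ-* _ _ ⟩
    - sgn m * sgn n       ≈⟨ *-congʳ (sym (sgn-suc m)) ⟩
    sgn (suc m) * sgn n   ∎

  sgn*sgn : ∀ n → sgn n * sgn n ≈ 1#
  sgn*sgn n with evenℕ n
  ... | true = *-identityˡ 1#
  ... | false = solve 0 (:- con (+ 1) :* :- con (+ 1) := con (+ 1)) refl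

  sgn-opposite : ∀ m n → ¬ evenℕ m ≡ evenℕ n → sgn m ≈ - sgn n
  sgn-opposite m n m≢n with evenℕ m | evenℕ n
  ... | true | true = ⊥-elim (m≢n ≡.refl)
  ... | true | false = sym (-‿involutive 1#)
  ... | false | true = refl
  ... | false | false = ⊥-elim (m≢n ≡.refl)

  neg-^ : ∀ y n → (- y) ^ n ≈ sgn n * y ^ n
  neg-^ y zero = sym (*-identityˡ 1#)
  neg-^ y (suc n) = begin
    - y * (- y) ^ n         ≈⟨ *-congˡ (neg-^ y n) ⟩
    - y * (sgn n * y ^ n)   ≈⟨ solve 3 (λ y s p → :- y :* (s :* p) := (:- s) :* (y :* p)) refl y (sgn n) (y ^ n) ⟩
    - sgn n * (y * y ^ n)   ≈⟨ *-congʳ (sym (sgn-suc n)) ⟩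
    sgn (suc n) * y ^ suc n ∎

  reflect : Poly → Poly
  reflect [] = []
  reflect (x ∷ p) = x ∷ scal (- 1#) (reflect p)

  eval-reflect : ∀ p t → eval (reflect p) t ≈ eval p (- t)
  eval-reflect [] t = refl
  eval-reflect (x ∷ p) t = +-congˡ (begin
    t * eval (scal (- 1#) (reflect p)) t ≈⟨ *-congˡ (trans (eval-scal (- 1#) (reflect p) t) (*-congˡ (eval-reflect p t))) ⟩
    t * (- 1# * eval p (- t))           ≈⟨ solve 2 (λ t e → t :* (:- con (+ 1) :* e) := (:- t) :* e) refl t _ ⟩
    - t * eval p (- t)                  ∎)

  coeff-reflect : ∀ p n → coeff (reflect p) n ≈ sgn n * coeff p n
  coeff-reflect [] n = sym (zeroʳ _)
  coeff-reflect (x ∷ p) zero = sym (*-identityˡ x)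
  coeff-reflect (x ∷ p) (suc n) = begin
    coeff (scal (- 1#) (reflect p)) n ≈⟨ trans (coeff-scal (- 1#) (reflect p) n) (*-congˡ (coeff-reflect p n)) ⟩
    - 1# * (sgn n * coeff p n)        ≈⟨ solve 2 (λ s c → :- con (+ 1) :* (s :* c) := (:- s) :* c) refl (sgn n) _ ⟩
    - sgn n * coeff p n               ≈⟨ *-congʳ (sym (sgn-suc n)) ⟩
    sgn (suc n) * coeff p n           ∎

  ∸-≤-half : ∀ J i → ¬ i ℕ.≤ ⌊ J /2⌋ → J ℕ.∸ i ℕ.≤ ⌊ J /2⌋
  ∸-≤-half J i i≰J/2 = ≡.subst (J ℕ.∸ i ℕ.≤_) (ℕ.m+n∸n≡m ⌊ J /2⌋ i) (ℕ.∸-monoˡ-≤ i J≤J/2+i)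
    where
    J≤J/2+i : J ℕ.≤ ⌊ J /2⌋ ℕ.+ i
    J≤J/2+i = ≡.subst (ℕ._≤ ⌊ J /2⌋ ℕ.+ i) (ℕ.⌊n/2⌋+⌈n/2⌉≡n J)
      (ℕ.+-monoʳ-≤ ⌊ J /2⌋ (ℕ.≤-trans (ℕ.⌊n/2⌋-mono (ℕ.n≤1+n (suc J))) (ℕ.≰⇒> i≰J/2)))

  module _ (J : ℕ) (a : ℕ → Poly) (γ : Carrier) (D : ℕ)
    (partner : ∀ i → i ℕ.≤ ⌊ J /2⌋ →
               shift γ (a i) ≈ₚ scal (sgn D) (compLin (- 1#) (γ - fromℕ J) (a (J ℕ.∸ i)))) where

    eval-partner-half : ∀ i → i ℕ.≤ ⌊ J /2⌋ → ∀ s →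
      eval (a i) (s + γ) ≈ sgn D * eval (a (J ℕ.∸ i)) (- s + (γ - fromℕ J))
    eval-partner-half i i≤J/2 s = begin
      eval (a i) (s + γ)                   ≈⟨ sym (eval-shift γ (a i) s) ⟩
      eval (shift γ (a i)) s
        ≈⟨ eval-≈ₚ (shift γ (a i)) (scal (sgn D) (compLin (- 1#) (γ - fromℕ J) (a (J ℕ.∸ i)))) (partner i i≤J/2) s ⟩
      eval (scal (sgn D) (compLin (- 1#) (γ - fromℕ J) (a (J ℕ.∸ i)))) s
        ≈⟨ trans (eval-scal (sgn D) (compLin (- 1#) (γ - fromℕ J) (a (J ℕ.∸ i))) s)
                 (*-congˡ (eval-compLin (- 1#) (γ - fromℕ J) (a (J ℕ.∸ i)) s)) ⟩
      sgn D * eval (a (J ℕ.∸ i)) (- 1# * s + (γ - fromℕ J))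
        ≈⟨ *-congˡ (eval-congʳ (a (J ℕ.∸ i)) (+-congʳ (-1*x≈-x s))) ⟩
      sgn D * eval (a (J ℕ.∸ i)) (- s + (γ - fromℕ J)) ∎

    -- For i above ⌊J/2⌋ apply the hypothesis to J − i and use sgn D² = 1.
    eval-partner : ∀ i → i ℕ.≤ J → ∀ s →
      eval (a i) (s + γ) ≈ sgn D * eval (a (J ℕ.∸ i)) (- s + (γ - fromℕ J))
    eval-partner i i≤J s with i ℕ.≤? ⌊ J /2⌋
    ... | yes i≤J/2 = eval-partner-half i i≤J/2 s
    ... | no i≰J/2 = begin
      eval (a i) (s + γ)
        ≈⟨ eval-congʳ (a i) (solve 3 (λ s γ j → s :+ γ := :- (:- s :+ :- j) :+ (γ :- j)) refl s γ (fromℕ J)) ⟩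
      eval (a i) (- s′ + (γ - fromℕ J))
        ≡⟨ ≡.cong (λ k → eval (a k) (- s′ + (γ - fromℕ J))) (≡.sym (ℕ.m∸[m∸n]≡n i≤J)) ⟩
      eval (a (J ℕ.∸ (J ℕ.∸ i))) (- s′ + (γ - fromℕ J))
        ≈⟨ sym (trans (*-congʳ (sgn*sgn D)) (*-identityˡ _)) ⟩
      (sgn D * sgn D) * eval (a (J ℕ.∸ (J ℕ.∸ i))) (- s′ + (γ - fromℕ J))
        ≈⟨ trans (*-assoc _ _ _) (*-congˡ (sym (eval-partner-half (J ℕ.∸ i) (∸-≤-half J i i≰J/2) s′))) ⟩
      sgn D * eval (a (J ℕ.∸ i)) (s′ + γ)
        ≈⟨ *-congˡ (eval-congʳ (a (J ℕ.∸ i))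
                     (solve 3 (λ s γ j → (:- s :+ :- j) :+ γ := :- s :+ (γ :- j)) refl s γ (fromℕ J))) ⟩
      sgn D * eval (a (J ℕ.∸ i)) (- s + (γ - fromℕ J)) ∎
      where s′ = - s - fromℕ J

    -- Reflecting about γ exchanges the summands i and J − i of L*(x), since 2h = J.
    eval-adjoint-reflect : ∀ h → h + h ≈ fromℕ J →
      ∀ x ε → (∀ u → eval x ((γ - h) - u) ≈ ε * eval x ((γ - h) + u)) →
      ∀ t → eval (adjoint J a x) (- t + γ) ≈ (sgn D * ε) * eval (adjoint J a x) (t + γ)
    eval-adjoint-reflect h 2h≈J x ε x-sym t = begin
      eval (adjoint J a x) (- t + γ)          ≈⟨ eval-adjoint J a x (- t + γ) ⟩
      sumK (suc J) (term (- t))               ≈⟨ sumK-cong (suc J) (λ i i<1+J → swap i (ℕ.≤-pred i<1+J)) ⟩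
      sumK (suc J) (λ i → (sgn D * ε) * term t (J ℕ.∸ i)) ≈⟨ sumK-distribˡ (suc J) _ _ ⟩
      (sgn D * ε) * sumK (suc J) (λ i → term t (J ℕ.∸ i)) ≈⟨ *-congˡ (sumK-reverse J (term t)) ⟩
      (sgn D * ε) * sumK (suc J) (term t)     ≈⟨ *-congˡ (sym (eval-adjoint J a x (t + γ))) ⟩
      (sgn D * ε) * eval (adjoint J a x) (t + γ) ∎
      where
      term : Carrier → ℕ → Carrier
      term u i = eval (a i) ((u + γ) - fromℕ i) * eval x ((u + γ) - fromℕ i)
      swap : ∀ i → i ℕ.≤ J → term (- t) i ≈ (sgn D * ε) * term t (J ℕ.∸ i)
      swap i i≤J = begin
        term (- t) i                                                ≈⟨ *-cong a-swap x-swap ⟩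
        (sgn D * eval (a (J ℕ.∸ i)) u) * (ε * eval x u)
          ≈⟨ solve 4 (λ σ A ε X → (σ :* A) :* (ε :* X) := (σ :* ε) :* (A :* X)) refl _ _ ε _ ⟩
        (sgn D * ε) * term t (J ℕ.∸ i)                              ∎
        where
        u = (t + γ) - fromℕ (J ℕ.∸ i)
        J-i = fromℕ-∸ i J i≤J
        a-swap : eval (a i) ((- t + γ) - fromℕ i) ≈ sgn D * eval (a (J ℕ.∸ i)) u
        a-swap = begin
          eval (a i) ((- t + γ) - fromℕ i)
            ≈⟨ eval-congʳ (a i) (solve 3 (λ t γ i → (:- t :+ γ) :- i := (:- t :- i) :+ γ) refl t γ (fromℕ i)) ⟩
          eval (a i) ((- t - fromℕ i) + γ)               ≈⟨ eval-partner i i≤J (- t - fromℕ i) ⟩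
          sgn D * eval (a (J ℕ.∸ i)) (- (- t - fromℕ i) + (γ - fromℕ J))
            ≈⟨ *-congˡ (eval-congʳ (a (J ℕ.∸ i)) (trans
                 (solve 4 (λ t γ i j → :- (:- t :- i) :+ (γ :- j) := (t :+ γ) :- (j :- i)) refl t γ (fromℕ i) (fromℕ J))
                 (+-congˡ (-‿cong (sym J-i))))) ⟩
          sgn D * eval (a (J ℕ.∸ i)) u                   ∎
        x-swap : eval x ((- t + γ) - fromℕ i) ≈ ε * eval x u
        x-swap = begin
          eval x ((- t + γ) - fromℕ i)
            ≈⟨ eval-congʳ x (solve 4 (λ t γ h i → (:- t :+ γ) :- i := (γ :- h) :- ((t :+ i) :- h)) refl t γ h (fromℕ i)) ⟩
          eval x ((γ - h) - ((t + fromℕ i) - h))         ≈⟨ x-sym _ ⟩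
          ε * eval x ((γ - h) + ((t + fromℕ i) - h))
            ≈⟨ *-congˡ (eval-congʳ x (trans
                 (solve 4 (λ t γ h i → (γ :- h) :+ ((t :+ i) :- h) := (t :+ γ) :- ((h :+ h) :- i)) refl t γ h (fromℕ i))
                 (+-congˡ (-‿cong (trans (+-congʳ 2h≈J) (sym J-i)))))) ⟩
          ε * eval x u                                   ∎

  module CharZeroField (isField : IsField) (charZero : CharZero) where

    x*y≈0⇒y≈0 : ∀ {x y} → ¬ x ≈ 0# → x * y ≈ 0# → y ≈ 0#
    x*y≈0⇒y≈0 {x} {y} x≉0 xy≈0 = begin
      y             ≈⟨ sym (*-identityˡ y) ⟩
      1# * y        ≈⟨ *-congʳ (sym (proj₂ x⁻¹)) ⟩
      (x * x′) * y  ≈⟨ solve 3 (λ x x′ y → (x :* x′) :* y := x′ :* (x :* y)) refl x (proj₁ x⁻¹) y ⟩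
      x′ * (x * y)  ≈⟨ *-congˡ xy≈0 ⟩
      x′ * 0#       ≈⟨ zeroʳ _ ⟩
      0#            ∎
      where
      x⁻¹ = proj₂ isField x x≉0
      x′ = proj₁ x⁻¹

    x≉0∧y≉0⇒x*y≉0 : ∀ {x y} → ¬ x ≈ 0# → ¬ y ≈ 0# → ¬ x * y ≈ 0#
    x≉0∧y≉0⇒x*y≉0 x≉0 y≉0 xy≈0 = y≉0 (x*y≈0⇒y≈0 x≉0 xy≈0)

    x+x≈0⇒x≈0 : ∀ {x} → x + x ≈ 0# → x ≈ 0#
    x+x≈0⇒x≈0 {x} x+x≈0 = x*y≈0⇒y≈0 (charZero 1)
      (trans (solve 1 (λ x → (con (+ 1) :+ (con (+ 1) :+ con (+ 0))) :* x := x :+ x) refl x) x+x≈0)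

    fromℕ-apart : ∀ {i j} → i ℕ.< j → ¬ fromℕ i ≈ fromℕ j
    fromℕ-apart {i} {j} i<j i≈j = charZero (j ℕ.∸ suc i) (begin
      fromℕ (suc (j ℕ.∸ suc i))                        ≈⟨ solve 2 (λ a b → b := (a :+ b) :- a) refl (fromℕ i) _ ⟩
      (fromℕ i + fromℕ (suc (j ℕ.∸ suc i))) - fromℕ i  ≈⟨ +-congʳ (sym (fromℕ-+ i _)) ⟩
      fromℕ (i ℕ.+ suc (j ℕ.∸ suc i)) - fromℕ i
        ≡⟨ ≡.cong (λ n → fromℕ n - fromℕ i) (≡.trans (ℕ.+-suc i _) (ℕ.m+[n∸m]≡n i<j)) ⟩
      fromℕ j - fromℕ i                                ≈⟨ +-congʳ (sym i≈j) ⟩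
      fromℕ i - fromℕ i                                ≈⟨ -‿inverseʳ _ ⟩
      0#                                               ∎)

    fromℕ-injective : ∀ {i j} → fromℕ i ≈ fromℕ j → i ≡ j
    fromℕ-injective {i} {j} i≈j with ℕ.<-cmp i j
    ... | tri< i<j _ _ = ⊥-elim (fromℕ-apart i<j i≈j)
    ... | tri≈ _ i≡j _ = i≡j
    ... | tri> _ _ j<i = ⊥-elim (fromℕ-apart j<i (sym i≈j))

    roots⇒≈[] : ∀ n p → length p ℕ.≤ n → (r : ℕ → Carrier) → (∀ {i j} → r i ≈ r j → i ≡ j) →
                (∀ i → eval p (r i) ≈ 0#) → p ≈ₚ []
    roots⇒≈[] n [] _ r r-injective roots m = refl
    roots⇒≈[] (suc n) (x ∷ p) (s≤s |p|≤n) r r-injective roots =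
      root∧quotient≈[]⇒≈[] (r 0) (x ∷ p) (roots 0)
        (roots⇒≈[] n Q (≡.subst (ℕ._≤ n) (≡.sym (length-quotient (r 0) x p)) |p|≤n) (λ i → r (suc i))
                   (λ ri≈rj → ℕ.suc-injective (r-injective ri≈rj)) Q-roots)
      where
      Q = quotient (r 0) (x ∷ p)
      Q-roots : ∀ i → eval Q (r (suc i)) ≈ 0#
      Q-roots i = x*y≈0⇒y≈0 (λ d≈0 → case r-injective (x∙y⁻¹≈ε⇒x≈y _ _ d≈0) of λ ()) (begin
        (r (suc i) - r 0) * eval Q (r (suc i))               ≈⟨ sym (+-identityˡ _) ⟩
        0# + (r (suc i) - r 0) * eval Q (r (suc i))          ≈⟨ +-congʳ (sym (roots 0)) ⟩
        eval (x ∷ p) (r 0) + (r (suc i) - r 0) * eval Q (r (suc i)) ≈⟨ sym (eval-quotient (r 0) (x ∷ p) (r (suc i))) ⟩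
        eval (x ∷ p) (r (suc i))                             ≈⟨ roots (suc i) ⟩
        0#                                                   ∎)

    -- The difference vanishes at the points fromℕ i, which are distinct in characteristic zero.
    ≈ₚ-from-eval : ∀ p q → (∀ t → eval p t ≈ eval q t) → p ≈ₚ q
    ≈ₚ-from-eval p q p≐q n = x∙y⁻¹≈ε⇒x≈y _ _ (begin
      coeff p n - coeff q n             ≈⟨ +-congˡ (sym (-1*x≈-x _)) ⟩
      coeff p n + - 1# * coeff q n      ≈⟨ +-congˡ (sym (coeff-scal (- 1#) q n)) ⟩
      coeff p n + coeff (scal (- 1#) q) n ≈⟨ sym (coeff-⊕ p (scal (- 1#) q) n) ⟩
      coeff d n                         ≈⟨ d≈0 n ⟩
      0#                                ∎)
      where
      d = p ⊕ scal (- 1#) q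
      d≈0 : d ≈ₚ []
      d≈0 = roots⇒≈[] (length d) d ℕ.≤-refl fromℕ fromℕ-injective (λ i → begin
        eval d (fromℕ i)                                    ≈⟨ eval-⊕ p (scal (- 1#) q) _ ⟩
        eval p (fromℕ i) + eval (scal (- 1#) q) (fromℕ i)   ≈⟨ +-cong (p≐q _) (eval-scal (- 1#) q _) ⟩
        eval q (fromℕ i) + - 1# * eval q (fromℕ i)          ≈⟨ solve 1 (λ b → b :+ :- con (+ 1) :* b := con (+ 0)) refl _ ⟩
        0#                                                  ∎)

    coeff-shift-⊕-scal : ∀ γ q b g i →
      coeff (shift γ (q ⊕ scal b g)) i ≈ coeff (shift γ q) i + b * coeff (shift γ g) i
    coeff-shift-⊕-scal γ q b g i =
      trans (≈ₚ-from-eval (shift γ (q ⊕ scal b g)) (shift γ q ⊕ scal b (shift γ g)) pointwise i)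
            (trans (coeff-⊕ (shift γ q) (scal b (shift γ g)) i) (+-congˡ (coeff-scal b (shift γ g) i)))
      where
      pointwise : ∀ t → eval (shift γ (q ⊕ scal b g)) t ≈ eval (shift γ q ⊕ scal b (shift γ g)) t
      pointwise t = begin
        eval (shift γ (q ⊕ scal b g)) t         ≈⟨ eval-shift γ (q ⊕ scal b g) t ⟩
        eval (q ⊕ scal b g) (t + γ)             ≈⟨ trans (eval-⊕ q (scal b g) _) (+-congˡ (eval-scal b g _)) ⟩
        eval q (t + γ) + b * eval g (t + γ)     ≈⟨ sym (+-cong (eval-shift γ q t) (*-congˡ (eval-shift γ g t))) ⟩
        eval (shift γ q) t + b * eval (shift γ g) t
          ≈⟨ sym (trans (eval-⊕ (shift γ q) _ t) (+-congˡ (eval-scal b (shift γ g) t))) ⟩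
        eval (shift γ q ⊕ scal b (shift γ g)) t ∎

    reflect-parity : ∀ q e → reflect q ≈ₚ scal (sgn e) q → ∀ n → ¬ evenℕ n ≡ evenℕ e → coeff q n ≈ 0#
    reflect-parity q e q-sym n n≢e = begin
      a                   ≈⟨ sym (trans (*-congʳ (sgn*sgn e)) (*-identityˡ a)) ⟩
      (sgn e * sgn e) * a ≈⟨ *-assoc _ _ a ⟩
      sgn e * (sgn e * a) ≈⟨ *-congˡ (x+x≈0⇒x≈0 twice≈0) ⟩
      sgn e * 0#          ≈⟨ zeroʳ _ ⟩
      0#                  ∎
      where
      a = coeff q n
      odd-part : - sgn e * a ≈ sgn e * a
      odd-part = begin
        - sgn e * a            ≈⟨ *-congʳ (sym (sgn-opposite n e n≢e)) ⟩
        sgn n * a              ≈⟨ sym (coeff-reflect q n) ⟩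
        coeff (reflect q) n    ≈⟨ trans (q-sym n) (coeff-scal (sgn e) q n) ⟩
        sgn e * a              ∎
      twice≈0 : sgn e * a + sgn e * a ≈ 0#
      twice≈0 = trans (+-congˡ (sym odd-part)) (solve 2 (λ s c → s :* c :+ (:- s) :* c := con (+ 0)) refl (sgn e) a)

    -- By Newton, L*(x) = Σ_ℓ b_ℓ(k) Δ^ℓ x(k − J), and the ℓ-th term has degree at most d + j with
    -- coefficient [k^{d+ℓ}]b_ℓ · c · j^{\underline ℓ} there (zero for ℓ > j).
    Top-adjoint : ∀ J a D → IsDeg J a (+ D) → ∀ {x j c} → Top x j c →
                  Top (adjoint J a x) (D ℕ.+ j) (c * indPoly J a (+ D) (fromℕ j))
    Top-adjoint J a D deg {x} {j} {c} x-top =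
      Top-≈ₚ expansion≈adjoint (Top-resp lead≈ (Top-sumₚ (suc J) term-top))
      where
      term : ℕ → Poly
      term l = bpoly J a l ⊛ shift (- fromℕ J) (Δ^ l x)
      expansion≈adjoint : sumₚ (suc J) term ≈ₚ adjoint J a x
      expansion≈adjoint = ≈ₚ-from-eval (sumₚ (suc J) term) (adjoint J a x) λ t → begin
        eval (sumₚ (suc J) term) t ≈⟨ eval-sumₚ (suc J) term t ⟩
        sumK (suc J) (λ l → eval (term l) t)
          ≈⟨ sumK-cong (suc J) (λ l _ → trans (eval-⊛ (bpoly J a l) _ t) (*-congˡ (eval-shift (- fromℕ J) (Δ^ l x) t))) ⟩
        sumK (suc J) (λ l → eval (bpoly J a l) t * eval (Δ^ l x) (t - fromℕ J)) ≈⟨ sym (eval-adjoint-Δ J a x t) ⟩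
        eval (adjoint J a x) t ∎
      b-top : ∀ l → l ℕ.≤ J → Top (bpoly J a l) (D ℕ.+ l) (coeff (bpoly J a l) (D ℕ.+ l))
      b-top l l≤J = top (λ n D+l<n → proj₁ deg l l≤J n (ℤ.+<+ D+l<n)) refl
      cs : ℕ → Carrier
      cs l = coeff (bpoly J a l) (D ℕ.+ l) * (c * fall (fromℕ j) l)
      term-top : ∀ l → l ℕ.< suc J → Top (term l) (D ℕ.+ j) (cs l)
      term-top l l<1+J with l ℕ.≤? j
      ... | yes l≤j = ≡.subst₂ (λ n e → Top (term l) n (coeff (bpoly J a l) (D ℕ.+ l) * (c * fall (fromℕ e) l)))
                        (≡.trans (ℕ.+-assoc D l (j ℕ.∸ l)) (≡.cong (D ℕ.+_) l+[j-l]≡j)) l+[j-l]≡j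
                        (Top-⊛ (b-top l (ℕ.≤-pred l<1+J)) (Top-shift (- fromℕ J) (Top-Δ^ l (j ℕ.∸ l) x-top′)))
        where
        l+[j-l]≡j = ℕ.m+[n∸m]≡n l≤j
        x-top′ = ≡.subst (λ n → Top x n c) (≡.sym l+[j-l]≡j) x-top
      ... | no l≰j = Top-resp (sym (trans (*-congˡ (trans (*-congˡ (fall-vanishes j<l)) (zeroʳ c))) (zeroʳ _)))
                       (Top-[] (term l) (D ℕ.+ j) (⊛-[]ʳ (bpoly J a l) _ (Top⇒≈[] (Top-shift (- fromℕ J)
                          (Top-[] (Δ^ l x) 0 (Δ^-vanishes x-top j<l))))))
        where j<l = ℕ.≰⇒> l≰j
      lead≈ : sumK (suc J) cs ≈ c * indPoly J a (+ D) (fromℕ j)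
      lead≈ = trans (sumK-cong (suc J) (λ l _ → solve 3 (λ b c f → b :* (c :* f) := c :* (b :* f)) refl _ c _))
                    (sumK-distribˡ (suc J) c _)

    -- Triangular elimination

    record Pivot {s} (Span : Poly → Set s) (γ : Carrier) (n : ℕ) : Set (c ⊔ ℓ ⊔ s) where
      field
        generator : Poly
        generator∈Span : Span generator
        lead : Carrier
        lead≉0 : ¬ lead ≈ 0#
        generator-top : Top (shift γ generator) n lead
        generator-parity : ∀ i → ¬ evenℕ i ≡ evenℕ n → coeff (shift γ generator) i ≈ 0#

    module Elimination {s} (γ : Carrier) (m : ℕ) (Span : Poly → Set s)
      (Span-null : ∀ {q} → (∀ t → eval q t ≈ 0#) → Span q)
      (Span-combine : ∀ {q q₁ q₂} b → (∀ t → eval q t ≈ eval q₁ t + b * eval q₂ t) →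
                      Span q₁ → Span q₂ → Span q)
      (pivot : ∀ n → n ℕ.≤ m → evenℕ n ≡ evenℕ m → Pivot Span γ n) where

      Reduced : ℕ → Poly → Set ℓ
      Reduced n q = ∀ i → n ℕ.≤ i ⊎ ¬ evenℕ i ≡ evenℕ m → coeff (shift γ q) i ≈ 0#

      Reduced-skip : ∀ n q → ¬ evenℕ n ≡ evenℕ m → Reduced (suc n) q → Reduced n q
      Reduced-skip n q n≢m q-red i (inj₂ i≢m) = q-red i (inj₂ i≢m)
      Reduced-skip n q n≢m q-red i (inj₁ n≤i) with i ℕ.≟ n
      ... | yes ≡.refl = q-red i (inj₂ n≢m)
      ... | no i≢n = q-red i (inj₁ (ℕ.≤∧≢⇒< n≤i (λ n≡i → i≢n (≡.sym n≡i))))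

      Reduced-eliminate : ∀ n q → (p : Pivot Span γ n) → evenℕ n ≡ evenℕ m → Reduced (suc n) q →
        ∀ b → coeff (shift γ q) n + b * Pivot.lead p ≈ 0# → Reduced n (q ⊕ scal b (Pivot.generator p))
      Reduced-eliminate n q p n≡m q-red b cancels i i-cond =
        trans (coeff-shift-⊕-scal γ q b generator i) (at-i (i ℕ.≟ n) i-cond)
        where
        open Pivot p
        both-vanish : ∀ {x y} → x ≈ 0# → y ≈ 0# → x + b * y ≈ 0#
        both-vanish x≈0 y≈0 = trans (+-cong x≈0 (trans (*-congˡ y≈0) (zeroʳ b))) (+-identityˡ 0#)
        at-i : Dec (i ≡ n) → n ℕ.≤ i ⊎ ¬ evenℕ i ≡ evenℕ m →
               coeff (shift γ q) i + b * coeff (shift γ generator) i ≈ 0#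
        at-i (yes ≡.refl) _ = trans (+-congˡ (*-congˡ (at generator-top))) cancels
        at-i (no i≢n) (inj₁ n≤i) = both-vanish (q-red i (inj₁ n<i)) (above generator-top i n<i)
          where n<i = ℕ.≤∧≢⇒< n≤i (λ n≡i → i≢n (≡.sym n≡i))
        at-i (no _) (inj₂ i≢m) =
          both-vanish (q-red i (inj₂ i≢m)) (generator-parity i (λ i≡n → i≢m (≡.trans i≡n n≡m)))

      Reduced-zero⇒Span : ∀ q → Reduced 0 q → Span q
      Reduced-zero⇒Span q q-red = Span-null λ t → begin
        eval q t                      ≈⟨ eval-congʳ q (solve 2 (λ t γ → t := (t :- γ) :+ γ) refl t γ) ⟩
        eval q ((t - γ) + γ)          ≈⟨ sym (eval-shift γ q (t - γ)) ⟩
        eval (shift γ q) (t - γ)      ≈⟨ eval-[] (shift γ q) (λ i → q-red i (inj₁ z≤n)) (t - γ) ⟩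
        0#                            ∎

      Reduced⇒Span : ∀ n → n ℕ.≤ suc m → ∀ q → Reduced n q → Span q
      Reduced⇒Span zero _ = Reduced-zero⇒Span
      Reduced⇒Span (suc n) n<1+m q q-red with evenℕ n Bool.≟ evenℕ m
      ... | no n≢m = Reduced⇒Span n (ℕ.m≤n⇒m≤1+n (ℕ.≤-pred n<1+m)) q (Reduced-skip n q n≢m q-red)
      ... | yes n≡m = Span-combine b q≐q′+bg
          (Reduced⇒Span n (ℕ.m≤n⇒m≤1+n (ℕ.≤-pred n<1+m)) q′ (Reduced-eliminate n q p n≡m q-red (- b) cancels))
          generator∈Span
        where
        p = pivot n (ℕ.≤-pred n<1+m) n≡m
        open Pivot p
        lead⁻¹ = proj₂ isField lead lead≉0
        b = coeff (shift γ q) n * proj₁ lead⁻¹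
        q′ = q ⊕ scal (- b) generator
        cancels : coeff (shift γ q) n + - b * lead ≈ 0#
        cancels = begin
          coeff (shift γ q) n + - (coeff (shift γ q) n * proj₁ lead⁻¹) * lead
            ≈⟨ solve 3 (λ c l′ l → c :+ :- (c :* l′) :* l := c :- c :* (l :* l′)) refl _ _ lead ⟩
          coeff (shift γ q) n - coeff (shift γ q) n * (lead * proj₁ lead⁻¹)
            ≈⟨ +-congˡ (-‿cong (trans (*-congˡ (proj₂ lead⁻¹)) (*-identityʳ _))) ⟩
          coeff (shift γ q) n - coeff (shift γ q) n ≈⟨ -‿inverseʳ _ ⟩
          0# ∎
        q≐q′+bg : ∀ t → eval q t ≈ eval q′ t + b * eval generator t
        q≐q′+bg t = sym (begin
          eval q′ t + b * eval generator t
            ≈⟨ +-congʳ (trans (eval-⊕ q (scal (- b) generator) t) (+-congˡ (eval-scal (- b) generator t))) ⟩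
          (eval q t + - b * eval generator t) + b * eval generator t
            ≈⟨ solve 3 (λ x b y → (x :+ :- b :* y) :+ b :* y := x) refl (eval q t) b (eval generator t) ⟩
          eval q t ∎)

    module Expansion (J : ℕ) (a : ℕ → Poly) (γ : Carrier) (D : ℕ)
      (deg : IsDeg J a (+ D)) (power-partible : PowerPartible J a γ (+ D))
      (α : ℕ → Carrier) (α≉0 : ∀ s → ¬ α s ≈ 0#) (h : Carrier) (2h≈J : h + h ≈ fromℕ J) (m : ℕ) where

      Y X : Poly
      Y = (- γ) ∷ 1# ∷ []
      X = (h - γ) ∷ 1# ∷ []

      x : ℕ → Poly
      x j = scal (α j) (pow X j)

      L*x : ℕ → Poly
      L*x j = adjoint J a (x j)

      x-top : ∀ j → Top (x j) j (α j)
      x-top j = Top-resp (*-identityʳ (α j)) (Top-scal (α j) (Top-pow-linear (h - γ) j))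

      low high : ℕ → Bool
      low i = evenℤ (+ i ℤ.- + m)
      high j = evenℤ (+ D ℤ.+ + j ℤ.- + m)

      #high : ℕ
      #high = natPart (+ m ℤ.- + D ℤ.+ + 1)

      expression : (ℕ → Carrier) → (ℕ → Carrier) → Poly
      expression u v = combination D low (pow Y) u ⊕ combination #high high L*x v

      eval-expression : ∀ u v t → eval (expression u v) t ≈
        eval (combination D low (pow Y) u) t + eval (combination #high high L*x v) t
      eval-expression u v t = eval-⊕ (combination D low (pow Y) u) (combination #high high L*x v) t

      Expressible : Poly → Set (c ⊔ ℓ)
      Expressible q = Σ (ℕ → Carrier) λ u → Σ (ℕ → Carrier) λ v → ∀ t → eval q t ≈ eval (expression u v) t

      Expressible-null : ∀ {q} → (∀ t → eval q t ≈ 0#) → Expressible q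
      Expressible-null {q} q≐0 = (λ _ → 0#) , (λ _ → 0#) , λ t → begin
        eval q t  ≈⟨ q≐0 t ⟩
        0#        ≈⟨ sym (+-identityˡ 0#) ⟩
        0# + 0#   ≈⟨ sym (+-cong (eval-combination-0 D low (pow Y) t) (eval-combination-0 #high high L*x t)) ⟩
        eval (combination D low (pow Y) _) t + eval (combination #high high L*x _) t
                  ≈⟨ sym (eval-expression _ _ t) ⟩
        eval (expression _ _) t ∎

      Expressible-combine : ∀ {q q₁ q₂} b → (∀ t → eval q t ≈ eval q₁ t + b * eval q₂ t) →
                            Expressible q₁ → Expressible q₂ → Expressible q
      Expressible-combine {q} {q₁} {q₂} b q≐ (u₁ , v₁ , q₁≐) (u₂ , v₂ , q₂≐) =
        (λ i → u₁ i + b * u₂ i) , (λ j → v₁ j + b * v₂ j) , λ t → begin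
          eval q t                                    ≈⟨ q≐ t ⟩
          eval q₁ t + b * eval q₂ t
            ≈⟨ +-cong (trans (q₁≐ t) (eval-expression u₁ v₁ t)) (*-congˡ (trans (q₂≐ t) (eval-expression u₂ v₂ t))) ⟩
          (U u₁ t + V v₁ t) + b * (U u₂ t + V v₂ t)
            ≈⟨ solve 5 (λ a₁ b₁ e a₂ b₂ → (a₁ :+ b₁) :+ e :* (a₂ :+ b₂) := (a₁ :+ e :* a₂) :+ (b₁ :+ e :* b₂))
                     refl (U u₁ t) (V v₁ t) b (U u₂ t) (V v₂ t) ⟩
          (U u₁ t + b * U u₂ t) + (V v₁ t + b * V v₂ t)
            ≈⟨ sym (+-cong (eval-combination-linear D low (pow Y) u₁ u₂ b t)
                           (eval-combination-linear #high high L*x v₁ v₂ b t)) ⟩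
          U (λ i → u₁ i + b * u₂ i) t + V (λ j → v₁ j + b * v₂ j) t ≈⟨ sym (eval-expression _ _ t) ⟩
          eval (expression _ _) t                     ∎
        where
        U V : (ℕ → Carrier) → Carrier → Carrier
        U u = eval (combination D low (pow Y) u)
        V v = eval (combination #high high L*x v)

      shift-pow-Y : ∀ n → shift γ (pow Y n) ≈ₚ monomial n
      shift-pow-Y n = ≈ₚ-from-eval (shift γ (pow Y n)) (monomial n) λ t → begin
        eval (shift γ (pow Y n)) t  ≈⟨ trans (eval-shift γ (pow Y n) t) (eval-pow Y n (t + γ)) ⟩
        eval Y (t + γ) ^ n
          ≈⟨ ^-congˡ n (trans (eval-linear (- γ) 1# (t + γ))
                              (solve 2 (λ γ t → :- γ :+ (t :+ γ) :* con (+ 1) := t) refl γ t)) ⟩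
        t ^ n                       ≈⟨ sym (eval-monomial n t) ⟩
        eval (monomial n) t         ∎

      eval-x : ∀ j w → eval (x j) ((γ - h) + w) ≈ α j * w ^ j
      eval-x j w = trans (eval-scal (α j) (pow X j) _) (*-congˡ (trans (eval-pow X j _) (^-congˡ j
        (trans (eval-linear (h - γ) 1# _) (solve 3 (λ h γ w → (h :- γ) :+ ((γ :- h) :+ w) :* con (+ 1) := w) refl h γ w)))))

      x-symmetric : ∀ j u → eval (x j) ((γ - h) - u) ≈ sgn j * eval (x j) ((γ - h) + u)
      x-symmetric j u = begin
        eval (x j) ((γ - h) - u)        ≈⟨ eval-x j (- u) ⟩
        α j * (- u) ^ j                 ≈⟨ *-congˡ (neg-^ u j) ⟩
        α j * (sgn j * u ^ j)           ≈⟨ solve 3 (λ a s p → a :* (s :* p) := s :* (a :* p)) refl (α j) (sgn j) (u ^ j) ⟩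
        sgn j * (α j * u ^ j)           ≈⟨ *-congˡ (sym (eval-x j u)) ⟩
        sgn j * eval (x j) ((γ - h) + u) ∎

      reflect-shift-adjoint : ∀ j →
        reflect (shift γ (L*x j)) ≈ₚ scal (sgn (D ℕ.+ j)) (shift γ (L*x j))
      reflect-shift-adjoint j = ≈ₚ-from-eval (reflect S) (scal (sgn (D ℕ.+ j)) S) λ t → begin
        eval (reflect S) t                        ≈⟨ trans (eval-reflect S t) (eval-shift γ P (- t)) ⟩
        eval P (- t + γ)
          ≈⟨ eval-adjoint-reflect J a γ D (proj₂ power-partible) h 2h≈J (x j) (sgn j) (x-symmetric j) t ⟩
        (sgn D * sgn j) * eval P (t + γ)          ≈⟨ *-cong (sym (sgn-+ D j)) (sym (eval-shift γ P t)) ⟩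
        sgn (D ℕ.+ j) * eval S t                  ≈⟨ sym (eval-scal (sgn (D ℕ.+ j)) S t) ⟩
        eval (scal (sgn (D ℕ.+ j)) S) t           ∎
        where
        P = L*x j
        S = shift γ P

      j<#high : ∀ j → D ℕ.+ j ℕ.≤ m → j ℕ.< #high
      j<#high j D+j≤m = ≡.subst (j ℕ.<_) (≡.sym #high≡) (≡.subst (j ℕ.<_) (ℕ.+-comm 1 (m ℕ.∸ D)) (s≤s j≤m-D))
        where
        D≤m = ℕ.m+n≤o⇒m≤o D D+j≤m
        #high≡ : #high ≡ (m ℕ.∸ D) ℕ.+ 1
        #high≡ = ≡.cong (λ z → natPart (z ℤ.+ + 1)) (≡.trans (ℤ.m-n≡m⊖n m D) (ℤ.⊖-≥ D≤m))
        j≤m-D : j ℕ.≤ m ℕ.∸ D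
        j≤m-D = ≡.subst (ℕ._≤ m ℕ.∸ D) (ℕ.m+n∸m≡n D j) (ℕ.∸-monoˡ-≤ D D+j≤m)

      pivot-low : ∀ n → n ℕ.< D → evenℕ n ≡ evenℕ m → Pivot Expressible γ n
      pivot-low n n<D n≡m = record
        { generator = pow Y n
        ; generator∈Span = δ n , (λ _ → 0#) , λ t → sym (begin
            eval (expression (δ n) (λ _ → 0#)) t ≈⟨ eval-expression _ _ t ⟩
            eval (combination D low (pow Y) (δ n)) t + eval (combination #high high L*x (λ _ → 0#)) t
              ≈⟨ +-cong (eval-combination-δ D low (pow Y) n t n<D (evenℤ-difference n m n≡m))
                        (eval-combination-0 #high high L*x t) ⟩
            eval (pow Y n) t + 0#                ≈⟨ +-identityʳ _ ⟩
            eval (pow Y n) t                     ∎)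
        ; lead = 1#
        ; lead≉0 = proj₁ isField
        ; generator-top = Top-≈ₚ (λ i → sym (shift-pow-Y n i)) (Top-monomial n)
        ; generator-parity = λ i i≢n → trans (shift-pow-Y n i) (coeff-monomial-≢ n i (λ i≡n → i≢n (≡.cong evenℕ i≡n)))
        }

      pivot-high : ∀ j → D ℕ.+ j ℕ.≤ m → evenℕ (D ℕ.+ j) ≡ evenℕ m → Pivot Expressible γ (D ℕ.+ j)
      pivot-high j D+j≤m D+j≡m = record
        { generator = L*x j
        ; generator∈Span = (λ _ → 0#) , δ j , λ t → sym (begin
            eval (expression (λ _ → 0#) (δ j)) t ≈⟨ eval-expression _ _ t ⟩
            eval (combination D low (pow Y) (λ _ → 0#)) t + eval (combination #high high L*x (δ j)) t
              ≈⟨ +-cong (eval-combination-0 D low (pow Y) t)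
                        (eval-combination-δ #high high L*x j t (j<#high j D+j≤m)
                                            (evenℤ-difference (D ℕ.+ j) m D+j≡m)) ⟩
            0# + eval (L*x j) t       ≈⟨ +-identityˡ _ ⟩
            eval (L*x j) t            ∎)
        ; lead = α j * indPoly J a (+ D) (fromℕ j)
        ; lead≉0 = x≉0∧y≉0⇒x*y≉0 (α≉0 j) (proj₁ power-partible j)
        ; generator-top = Top-shift γ (Top-adjoint J a D deg (x-top j))
        ; generator-parity = reflect-parity (shift γ (L*x j)) (D ℕ.+ j) (reflect-shift-adjoint j)
        }

      pivot : ∀ n → n ℕ.≤ m → evenℕ n ≡ evenℕ m → Pivot Expressible γ n
      pivot n n≤m n≡m with n ℕ.<? D
      ... | yes n<D = pivot-low n n<D n≡m
      ... | no n≮D = ≡.subst (Pivot Expressible γ) D+j≡n (pivot-high (n ℕ.∸ D)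
          (≡.subst (ℕ._≤ m) (≡.sym D+j≡n) n≤m) (≡.subst (λ k → evenℕ k ≡ evenℕ m) (≡.sym D+j≡n) n≡m))
        where D+j≡n = ℕ.m+[n∸m]≡n (ℕ.≮⇒≥ n≮D)

      open Elimination γ m Expressible (λ {q} → Expressible-null {q})
                       (λ {q q₁ q₂} → Expressible-combine {q} {q₁} {q₂}) pivot

      power-expressible : Expressible (pow Y m)
      power-expressible = Reduced⇒Span (suc m) ℕ.≤-refl (pow Y m) λ i i-cond →
        trans (shift-pow-Y m i) (coeff-monomial-≢ m i (i≢m i-cond))
        where
        i≢m : ∀ {i} → suc m ℕ.≤ i ⊎ ¬ evenℕ i ≡ evenℕ m → ¬ i ≡ m
        i≢m (inj₁ m<i) ≡.refl = ℕ.<-irrefl ≡.refl m<i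
        i≢m (inj₂ i≢m) ≡.refl = i≢m ≡.refl

theorem2p6 : {c ℓ : Level} (R : CommutativeRing c ℓ) →
    let open CommutativeRing R
        open PolyDefs R
    in IsField → CharZero →
       (J : ℕ) (a : ℕ → Poly) → ¬ (a J ≈ₚ []) →
       (γ : Carrier) (d : ℤ) → IsDeg J a d → PowerPartible J a γ d →
       (α : ℕ → Carrier) → (∀ s → ¬ (α s ≈ 0#)) →
       (h : Carrier) → h + h ≈ fromℕ J →
       (m : ℕ) → 1 Data.Nat.≤ m →
       Σ (ℕ → Carrier) λ u → Σ (ℕ → Carrier) λ v →
         pow ((- γ) ∷ 1# ∷ []) m ≈ₚ
           sumIf (natPart d) (λ i → evenℤ (+ i ℤ.- + m))
                 (λ i → scal (u i) (pow ((- γ) ∷ 1# ∷ []) i))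
           ⊕ sumIf (natPart (+ m ℤ.- d ℤ.+ + 1)) (λ j → evenℤ (d ℤ.+ + j ℤ.- + m))
                 (λ j → scal (v j) (adjoint J a (scal (α j) (pow ((h - γ) ∷ 1# ∷ []) j))))
theorem2p6 R isField charZero J a _ γ (+ D) deg power-partible α α≉0 h 2h≈J m _ =
  u , v , ≈ₚ-from-eval (pow Y m) (expression u v) pow≐expression
  where
  open PolyDefs R using (pow)
  open CharZeroField R isField charZero
  open Expansion J a γ D deg power-partible α α≉0 h 2h≈J m
  u = proj₁ power-expressible
  v = proj₁ (proj₂ power-expressible)
  pow≐expression = proj₂ (proj₂ power-expressible)
theorem2p6 R isField charZero J a _ γ -[1+ n ] deg power-partible =
  ⊥-elim (negative-degree-degenerate R J a n (proj₁ power-partible))
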